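{- Let $k \ge 2$ be an integer. Then: (1) $d_k(P_n) = \left\lceil \frac{n}{k+1} \right\rceil$ for every $n \ge 2$; (2) $d_k(C_n) = \max\left\{2, \left\lceil \frac{n}{k+1} \right\rceil\right\}$ for every $n \ge 3$; (3) $d_k(K_n) = n-1$ for every $n \ge 2$.
   Context: $P_n$, $C_n$, $K_n$ denote the path, cycle and complete graph on $n$ vertices. The $k$-move deduction game ($k$ a positive integer) on a finite graph $G$: a layout places a finite number of searchers on vertices of $G$ (several searchers may share a vertex). Every searcher is initially mobile. A vertex is protected once it has been occupied by some searcher (so initially occupied vertices are protected); other vertices are unprotected. The game proceeds in stages. At each stage, for every vertex $v$ that has at least one unprotected neighbour: if the number of mobile searchers on $v$ is at least the number of unprotected neighbours of $v$, then the mobile searchers on $v$ move to the unprotected neighbours of $v$ so that each unprotected neighbour receives at least one searcher; excess mobile searchers on $v$ may also move to any of these unprotected neighbours. All moves in a stage happen simultaneously, newly occupied vertices become protected, and a searcher that has moved $k$ times becomes immobile. The process repeats until all vertices are protected or no searcher can move. A layout is successful if all vertices of $G$ end up protected. The $k$-move deduction number $d_k(G)$ is the minimum number of searchers in a successful layout on $G$. -}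

module Defs where

open import Data.Nat using (ℕ; zero; suc; _+_; _∸_; _≤_; _<ᵇ_; _≤ᵇ_; _⊔_)
import Data.Nat as ℕ
open import Data.Nat.DivMod using (_/_)
open import Data.Fin using (Fin; toℕ)
import Data.Fin as Fin
open import Data.Bool using (Bool; true; false; _∧_; _∨_; not; T; if_then_else_)
open import Data.Product using (Σ; ∃; _×_; _,_)
open import Data.Sum using (_⊎_)
open import Relation.Nullary.Decidable using (⌊_⌋)
open import Relation.Binary.PropositionalEquality using (_≡_)
open import Relation.Binary.Construct.Closure.ReflexiveTransitive using (Star)

Adj : ℕ → Set
Adj n = Fin n → Fin n → Bool

pathAdj : (n : ℕ) → Adj n
pathAdj n i j = ⌊ suc (toℕ i) ℕ.≟ toℕ j ⌋ ∨ ⌊ suc (toℕ j) ℕ.≟ toℕ i ⌋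

cycleAdj : (n : ℕ) → Adj n
cycleAdj n i j = pathAdj n i j
  ∨ (⌊ toℕ i ℕ.≟ 0 ⌋ ∧ ⌊ toℕ j ℕ.≟ n ∸ 1 ⌋)
  ∨ (⌊ toℕ j ℕ.≟ 0 ⌋ ∧ ⌊ toℕ i ℕ.≟ n ∸ 1 ⌋)

completeAdj : (n : ℕ) → Adj n
completeAdj n i j = not ⌊ i Fin.≟ j ⌋

count : ∀ {n} → (Fin n → Bool) → ℕ
count {zero} f = 0
count {suc n} f = (if f Fin.zero then 1 else 0) + count (λ i → f (Fin.suc i))

-- Game state with m searchers on a graph with n vertices:
-- position of each searcher, number of moves it has made, protected vertices.
record State (n m : ℕ) : Set where
  constructor state
  field
    pos  : Fin m → Fin n
    used : Fin m → ℕ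
    prot : Fin n → Bool
open State public

module Game (k : ℕ) {n : ℕ} (G : Adj n) where

  occupied : ∀ {m} → (Fin m → Fin n) → Fin n → Bool
  occupied p u = 0 <ᵇ count (λ i → ⌊ p i Fin.≟ u ⌋)

  module _ {m : ℕ} (s : State n m) where
    mobile : Fin m → Bool
    mobile i = used s i <ᵇ k

    unprotNbr : Fin n → Fin n → Bool
    unprotNbr v u = G v u ∧ not (prot s u)

    active : Fin n → Bool
    active v = (0 <ᵇ count (unprotNbr v))
             ∧ (count (unprotNbr v) ≤ᵇ count (λ i → ⌊ pos s i Fin.≟ v ⌋ ∧ mobile i))

    canMove : Fin m → Bool
    canMove i = mobile i ∧ active (pos s i)

  -- One stage of the game (a relation, since excess searchers have choices).
  Step : ∀ {m} → State n m → State n m → Set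
  Step {m} s s' =
      -- searchers that can move either move to an unprotected neighbour
      -- (using one move) or (as excess searchers) stay
      (∀ i → T (canMove s i) →
         (T (unprotNbr s (pos s i) (pos s' i)) × used s' i ≡ suc (used s i))
         ⊎ (pos s' i ≡ pos s i × used s' i ≡ used s i))
    ×
      (∀ i → T (not (canMove s i)) → pos s' i ≡ pos s i × used s' i ≡ used s i)
    × (∀ v u → T (active s v) → T (unprotNbr s v u) →
         ∃ λ i → pos s i ≡ v × T (mobile s i) × pos s' i ≡ u)
    × (∀ u → prot s' u ≡ (prot s u ∨ occupied (pos s') u))

  initial : ∀ {m} → (Fin m → Fin n) → State n m
  initial p = state p (λ _ → 0) (occupied p)

  Successful : ∀ {m} → (Fin m → Fin n) → Set
  Successful {m} p = ∃ λ (s : State n m) → Star Step (initial p) s × (∀ u → T (prot s u))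

IsDeductionNumber : (k : ℕ) → ∀ {n} → Adj n → ℕ → Set
IsDeductionNumber k {n} G d =
  (Σ (Fin d → Fin n) (Game.Successful k G))
  × (∀ m (p : Fin m → Fin n) → Game.Successful k G p → d ≤ m)

-- ⌈ n / (k+1) ⌉
ceilDiv : ℕ → ℕ → ℕ
ceilDiv n k = (n + k) / suc k

{-# OPTIONS --safe #-}
-- A searcher protects at most the k + 1 vertices it visits, so a successful layout
-- has n ≤ m (k + 1).  Some layouts are inert: no vertex ever hosts as many mobile
-- searchers as it has unprotected neighbours, so only the occupied vertices get
-- protected.  This happens for one searcher on a cycle, and for at most n - 2
-- searchers on K_n, where an occupied vertex sees more unoccupied vertices than it
-- hosts searchers.
--
-- Conversely, n - 1 searchers on K_n all move to the free vertex, and one searcher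
-- walks along a path with at most k + 1 vertices.  Otherwise one searcher starts at
-- the last vertex and walks k steps back, while the others start at 0, k + 1,
-- 2 (k + 1), ..., packed closer near the end so that any two stay two apart and
-- clear of the range of the back searcher.  A searcher between two unprotected
-- neighbours cannot move, so the front searcher walks right until it meets the
-- next one, which then takes over.  Both ends being occupied from the start, the
-- extra edge of a cycle never leads to an unprotected vertex, and the same layout
-- works for C_n.
module Submission where

open import Defs
open import Data.Bool using (Bool; true; false; _∧_; _∨_; not; T; if_then_else_)
open import Data.Bool.Properties using (T-∧; T-∨; T-≡; T-not-≡; ∨-idem; ∧-identityʳ)
open import Data.Empty using (⊥; ⊥-elim)
open import Data.Fin using (Fin; zero; suc; toℕ)
import Data.Fin as Fin
import Data.Fin.Properties as Finₚ
open import Data.Nat using (ℕ; zero; suc; _+_; _*_; _∸_; _⊓_; _⊔_; _≤_; _<_; _<ᵇ_; _≤ᵇ_; z≤n; s≤s)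
open import Data.Nat.Solver using (module +-*-Solver)
open import Data.Nat.DivMod using (_%_; m≡m%n+[m/n]*n; m%n<n; m/n*n≤m; m<n*o⇒m/o<n)
open import Data.Nat.Properties
open import Algebra.Properties.CommutativeSemigroup +-commutativeSemigroup using (interchange; xy∙z≈xz∙y)
open import Data.Product using (Σ; ∃; _×_; _,_; proj₁; proj₂)
open import Data.Sum using (_⊎_; inj₁; inj₂; [_,_]′)
open import Data.Unit using (tt)
open import Function using (_∘_; const; id)
open import Function.Bundles using (Equivalence)
open import Relation.Binary.PropositionalEquality
open import Relation.Binary.Construct.Closure.ReflexiveTransitive using (Star; ε; _◅_; fold)
open import Relation.Nullary using (¬_; yes; no)
open import Relation.Binary using (tri<; tri≈; tri>)
open import Relation.Nullary.Decidable using (⌊_⌋; toWitness; fromWitness; toWitnessFalse; fromWitnessFalse)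

open Equivalence using (to; from)

suc[n∸1]≡n : ∀ {n} → 0 < n → suc (n ∸ 1) ≡ n
suc[n∸1]≡n {suc n} _ = refl

<⇒≤∸1 : ∀ {m n} → m < n → m ≤ n ∸ 1
<⇒≤∸1 {n = suc n} (s≤s m≤n) = m≤n

2+m≤n⇒m<n∸1 : ∀ {m n} → 2 + m ≤ n → m < n ∸ 1
2+m≤n⇒m<n∸1 {n = suc n} (s≤s 1+m≤n) = 1+m≤n

[k+b]∸[1+k]≡b∸1 : ∀ k b → (k + b) ∸ suc k ≡ b ∸ 1
[k+b]∸[1+k]≡b∸1 zero b = refl
[k+b]∸[1+k]≡b∸1 (suc k) b = [k+b]∸[1+k]≡b∸1 k b

-- Counting

T-not⇒¬T : ∀ {b} → T (not b) → ¬ T b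
T-not⇒¬T {false} _ ()

¬T⇒T-not : ∀ {b} → ¬ T b → T (not b)
¬T⇒T-not {true} ¬b = ¬b tt
¬T⇒T-not {false} _ = tt

ind : Bool → ℕ
ind b = if b then 1 else 0

ind-true : ∀ {b} → T b → ind b ≡ 1
ind-true {true} _ = refl

ind-false : ∀ {b} → ¬ T b → ind b ≡ 0
ind-false {true} ¬b = ⊥-elim (¬b tt)
ind-false {false} _ = refl

ind≤1 : ∀ b → ind b ≤ 1
ind≤1 true = ≤-refl
ind≤1 false = z≤n

ind-mono : ∀ {a b} → (T a → T b) → ind a ≤ ind b
ind-mono {false} _ = z≤n
ind-mono {true} a⇒b = ≤-reflexive (sym (ind-true (a⇒b tt)))

ind-∨ : ∀ a b → ind (a ∨ b) ≤ ind a + ind b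
ind-∨ true _ = s≤s z≤n
ind-∨ false _ = ≤-refl

ind-not : ∀ b → ind b + ind (not b) ≡ 1
ind-not true = refl
ind-not false = refl

count-cong : ∀ {n} {f g : Fin n → Bool} → (∀ x → f x ≡ g x) → count f ≡ count g
count-cong {zero} _ = refl
count-cong {suc n} f≗g = cong₂ _+_ (cong ind (f≗g zero)) (count-cong (f≗g ∘ suc))

count-mono : ∀ {n} (f g : Fin n → Bool) → (∀ x → T (f x) → T (g x)) → count f ≤ count g
count-mono {zero} _ _ _ = z≤n
count-mono {suc n} f g f⊆g = +-mono-≤ (ind-mono (f⊆g zero)) (count-mono (f ∘ suc) (g ∘ suc) (f⊆g ∘ suc))

count-∨ : ∀ {n} (f g : Fin n → Bool) → count (λ x → f x ∨ g x) ≤ count f + count g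
count-∨ {zero} _ _ = z≤n
count-∨ {suc n} f g = ≤-trans (+-mono-≤ (ind-∨ (f zero) (g zero)) (count-∨ (f ∘ suc) (g ∘ suc)))
                              (≤-reflexive (interchange (ind (f zero)) _ _ _))

count-complement : ∀ {n} (f : Fin n → Bool) → count f + count (not ∘ f) ≡ n
count-complement {zero} _ = refl
count-complement {suc n} f = trans (interchange (ind (f zero)) _ _ _)
                                   (cong₂ _+_ (ind-not (f zero)) (count-complement (f ∘ suc)))

count-all : ∀ {n} (f : Fin n → Bool) → (∀ x → T (f x)) → count f ≡ n
count-all {zero} _ _ = refl
count-all {suc n} f all = cong₂ _+_ (ind-true (all zero)) (count-all (f ∘ suc) (all ∘ suc))

count-none : ∀ {n} (f : Fin n → Bool) → (∀ x → ¬ T (f x)) → count f ≡ 0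
count-none {zero} _ _ = refl
count-none {suc n} f none = cong₂ _+_ (ind-false (none zero)) (count-none (f ∘ suc) (none ∘ suc))

count>0 : ∀ {n} (f : Fin n → Bool) x → T (f x) → 0 < count f
count>0 f zero fx = ≤-trans (≤-reflexive (sym (ind-true fx))) (m≤m+n _ _)
count>0 f (suc x) fx = ≤-trans (count>0 (f ∘ suc) x fx) (m≤n+m _ _)

count>0⇒∃ : ∀ {n} (f : Fin n → Bool) → 0 < count f → ∃ λ x → T (f x)
count>0⇒∃ {zero} _ ()
count>0⇒∃ {suc n} f pos with f zero in eq
... | true = zero , subst T (sym eq) tt
... | false = let x , fx = count>0⇒∃ (f ∘ suc) pos in suc x , fx

count≤1 : ∀ {n} (f : Fin n → Bool) a → (∀ x → T (f x) → x ≡ a) → count f ≤ 1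
count≤1 {suc n} f zero only-a = +-mono-≤ (ind≤1 (f zero))
  (≤-reflexive (count-none (f ∘ suc) (λ x fx → Finₚ.0≢1+n (sym (only-a (suc x) fx)))))
count≤1 {suc n} f (suc a) only-a = subst (_≤ 1) (cong (_+ count (f ∘ suc)) (sym f0≡0))
  (count≤1 (f ∘ suc) a (λ x fx → Finₚ.suc-injective (only-a (suc x) fx)))
  where
    f0≡0 : ind (f zero) ≡ 0
    f0≡0 = ind-false (λ f0 → Finₚ.0≢1+n (only-a zero f0))

count≥2 : ∀ {n} (f : Fin n → Bool) a b → T (f a) → T (f b) → a ≢ b → 2 ≤ count f
count≥2 f zero zero _ _ a≢b = ⊥-elim (a≢b refl)
count≥2 f zero (suc b) fa fb _ = +-mono-≤ (≤-reflexive (sym (ind-true fa))) (count>0 (f ∘ suc) b fb)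
count≥2 f (suc a) zero fa fb _ = +-mono-≤ (≤-reflexive (sym (ind-true fb))) (count>0 (f ∘ suc) a fa)
count≥2 f (suc a) (suc b) fa fb a≢b =
  ≤-trans (count≥2 (f ∘ suc) a b fa fb (a≢b ∘ cong suc)) (m≤n+m _ (ind (f zero)))

count-insert : ∀ {n} (A A′ : Fin n → Bool) a → (∀ u → T (A u) → u ≡ a ⊎ T (A′ u)) → count A ≤ suc (count A′)
count-insert A A′ a split = begin
  count A                                   ≤⟨ count-mono A _ A⊆ ⟩
  count (λ u → ⌊ a Fin.≟ u ⌋ ∨ A′ u)         ≤⟨ count-∨ _ A′ ⟩
  count (λ u → ⌊ a Fin.≟ u ⌋) + count A′     ≤⟨ +-monoˡ-≤ (count A′) (count≤1 _ a (λ _ → sym ∘ toWitness)) ⟩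
  suc (count A′)                            ∎
  where
    open ≤-Reasoning
    A⊆ : ∀ u → T (A u) → T (⌊ a Fin.≟ u ⌋ ∨ A′ u)
    A⊆ u Au with split u Au
    ... | inj₁ u≡a = from (T-∨ {⌊ a Fin.≟ u ⌋}) (inj₁ (fromWitness (sym u≡a)))
    ... | inj₂ A′u = from (T-∨ {⌊ a Fin.≟ u ⌋}) (inj₂ A′u)

count-image : ∀ {n m} (A : Fin n → Bool) (B : Fin m → Bool) (g : Fin m → Fin n) →
  (∀ u → T (A u) → ∃ λ i → T (B i) × g i ≡ u) → count A ≤ count B
count-image {m = zero} A B g cover = ≤-reflexive (count-none A (λ u Au → case (cover u Au)))
  where case : ∀ {u} → ∃ (λ (i : Fin 0) → T (B i) × g i ≡ u) → ⊥
        case (() , _)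
count-image {n} {suc m} A B g cover with B zero in eq
... | false = count-image A (B ∘ suc) (g ∘ suc) cover′
  where
    cover′ : ∀ u → T (A u) → ∃ λ i → T (B (suc i)) × g (suc i) ≡ u
    cover′ u Au with cover u Au
    ... | zero , B0 , _ = ⊥-elim (subst T eq B0)
    ... | suc i , Bi , gi≡u = i , Bi , gi≡u
... | true = ≤-trans (count-insert A A′ (g zero) split) (s≤s (count-image A′ (B ∘ suc) (g ∘ suc) cover′))
  where
    A′ : Fin n → Bool
    A′ u = A u ∧ not ⌊ g zero Fin.≟ u ⌋
    split : ∀ u → T (A u) → u ≡ g zero ⊎ T (A′ u)
    split u Au with g zero Fin.≟ u
    ... | yes g0≡u = inj₁ (sym g0≡u)
    ... | no _ = inj₂ (from T-∧ (Au , tt))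
    cover′ : ∀ u → T (A′ u) → ∃ λ i → T (B (suc i)) × g (suc i) ≡ u
    cover′ u A′u with to T-∧ A′u
    ... | Au , g0≢u with cover u Au
    ...   | zero , _ , g0≡u = ⊥-elim (toWitnessFalse g0≢u g0≡u)
    ...   | suc i , Bi , gi≡u = i , Bi , gi≡u

∑ : ∀ {m} → (Fin m → ℕ) → ℕ
∑ {zero} _ = 0
∑ {suc m} f = f zero + ∑ (f ∘ suc)

∑-mono : ∀ {m} (f g : Fin m → ℕ) → (∀ i → f i ≤ g i) → ∑ f ≤ ∑ g
∑-mono {zero} _ _ _ = z≤n
∑-mono {suc m} f g f≤g = +-mono-≤ (f≤g zero) (∑-mono (f ∘ suc) (g ∘ suc) (f≤g ∘ suc))

∑-const : ∀ m c → ∑ {m} (const c) ≡ m * c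
∑-const zero _ = refl
∑-const (suc m) c = cong (c +_) (∑-const m c)

∑-+-count : ∀ {m} (f g : Fin m → ℕ) (b : Fin m → Bool) → (∀ i → g i ≡ f i + ind (b i)) →
  ∑ g ≡ ∑ f + count b
∑-+-count {zero} _ _ _ _ = refl
∑-+-count {suc m} f g b g≗f+b =
  trans (cong₂ _+_ (g≗f+b zero) (∑-+-count (f ∘ suc) (g ∘ suc) (b ∘ suc) (g≗f+b ∘ suc))) (interchange (f zero) _ _ _)

-- Plays

module GameProperties (k : ℕ) {n : ℕ} (G : Adj n) where
  open Game k G

  occupied-intro : ∀ {m} (p : Fin m → Fin n) {u} i → p i ≡ u → T (occupied p u)
  occupied-intro p i pi≡u = <⇒<ᵇ (count>0 _ i (fromWitness pi≡u))

  occupied-elim : ∀ {m} (p : Fin m → Fin n) {u} → T (occupied p u) → ∃ λ i → p i ≡ u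
  occupied-elim p occ = let i , pi≡u = count>0⇒∃ _ (<ᵇ⇒< 0 _ occ) in i , toWitness pi≡u

  count-occupied≤ : ∀ {m} (p : Fin m → Fin n) → count (occupied p) ≤ m
  count-occupied≤ {m} p = ≤-trans
    (count-image (occupied p) (const true) p (λ u occ → let i , pi≡u = occupied-elim p occ in i , tt , pi≡u))
    (≤-reflexive (count-all {m} (const true) (const tt)))

  module _ {m : ℕ} (s : State n m) where
    mobileAt : Fin n → Fin m → Bool
    mobileAt v i = ⌊ pos s i Fin.≟ v ⌋ ∧ mobile s i

  mobileAt⇒at : ∀ {m} {s : State n m} {v} i → T (mobileAt s v i) → pos s i ≡ v
  mobileAt⇒at {s = s} {v} i at = toWitness (proj₁ (to (T-∧ {⌊ pos s i Fin.≟ v ⌋}) at))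

  active-intro : ∀ {m} {s : State n m} {v u} i → pos s i ≡ v → T (mobile s i) → T (unprotNbr s v u) →
    (∀ w → T (unprotNbr s v w) → w ≡ u) → T (active s v)
  active-intro {s = s} {v} {u} i pi≡v mob vu unique = from T-∧
    ( <⇒<ᵇ (count>0 (unprotNbr s v) u vu)
    , ≤⇒≤ᵇ (≤-trans (count≤1 _ u unique) (count>0 (mobileAt s v) i (from T-∧ (fromWitness pi≡v , mob)))))

  active-counts : ∀ {m} {s : State n m} {v} → T (active s v) →
    0 < count (unprotNbr s v) × count (unprotNbr s v) ≤ count (mobileAt s v)
  active-counts act = let some , enough = to T-∧ act in <ᵇ⇒< 0 _ some , ≤ᵇ⇒≤ _ _ enough

  active-elim : ∀ {m} {s : State n m} {v} → T (active s v) → ∃ λ i → pos s i ≡ v × T (mobile s i)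
  active-elim {s = s} {v} act with active-counts {s = s} {v} act
  ... | some , enough with count>0⇒∃ (mobileAt s v) (<-≤-trans some enough)
  ...   | i , at-v = let here , mob = to T-∧ at-v in i , toWitness here , mob

  moved-or-stayed : ∀ {m} {s s′ : State n m} → Step s s′ → ∀ i →
    (T (mobile s i) × used s′ i ≡ suc (used s i)) ⊎ (pos s′ i ≡ pos s i × used s′ i ≡ used s i)
  moved-or-stayed {s = s} (movers , others , _ , _) i with canMove s i in eq
  ... | false = inj₂ (others i (from T-not-≡ eq))
  ... | true with movers i (from T-≡ eq)
  ...   | inj₁ (_ , used+1) = inj₁ (proj₁ (to T-∧ (from T-≡ eq)) , used+1)
  ...   | inj₂ stayed = inj₂ stayed

  invariant-along : ∀ {m} (Inv : State n m → Set) → (∀ {s s′} → Step s s′ → Inv s → Inv s′) →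
    ∀ {s s′} → Star Step s s′ → Inv s → Inv s′
  invariant-along Inv preserved = fold (λ s s′ → Inv s → Inv s′) (λ step rest → rest ∘ preserved step) id

  record Budgeted {m} (s : State n m) : Set where
    field
      used≤k : ∀ i → used s i ≤ k
      occupied⇒prot : ∀ u → T (occupied (pos s) u) → T (prot s u)
      count-prot≤ : count (prot s) ≤ ∑ (λ i → suc (used s i))

  budgeted-initial : ∀ {m} (p : Fin m → Fin n) → Budgeted (initial p)
  budgeted-initial {m} p = record
    { used≤k = λ _ → z≤n
    ; occupied⇒prot = λ _ occ → occ
    ; count-prot≤ = ≤-trans (count-occupied≤ p) (≤-reflexive (sym (trans (∑-const m 1) (*-identityʳ m))))
    }

  budgeted-step : ∀ {m} {s s′ : State n m} → Step s s′ → Budgeted s → Budgeted s′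
  budgeted-step {m} {s} {s′} step@(_ , _ , _ , prot′) B = record
    { used≤k = used≤k′
    ; occupied⇒prot = λ u occ → subst T (sym (prot′ u)) (from (T-∨ {prot s u}) (inj₂ occ))
    ; count-prot≤ = begin
        count (prot s′)                           ≤⟨ count-mono (prot s′) _ old-or-new ⟩
        count (λ u → prot s u ∨ new u)            ≤⟨ count-∨ (prot s) new ⟩
        count (prot s) + count new                ≤⟨ +-mono-≤ count-prot≤ (count-image new mover (pos s′) new⇐mover) ⟩
        ∑ (λ i → suc (used s i)) + count mover   ≡⟨ sym (∑-+-count _ _ mover used′) ⟩
        ∑ (λ i → suc (used s′ i))                 ∎
    }
    where
      open Budgeted B
      open ≤-Reasoning
      new : Fin n → Bool
      new u = not (prot s u) ∧ occupied (pos s′) u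
      mover : Fin m → Bool
      mover i = ⌊ used s′ i ≟ suc (used s i) ⌋
      used≤k′ : ∀ i → used s′ i ≤ k
      used≤k′ i with moved-or-stayed step i
      ... | inj₁ (mob , used+1) = subst (_≤ k) (sym used+1) (<ᵇ⇒< _ _ mob)
      ... | inj₂ (_ , same) = subst (_≤ k) (sym same) (used≤k i)
      old-or-new : ∀ u → T (prot s′ u) → T (prot s u ∨ new u)
      old-or-new u p′ with prot s u in eq
      ... | true = tt
      ... | false = subst T (trans (prot′ u) (cong (_∨ occupied (pos s′) u) eq)) p′
      new⇐mover : ∀ u → T (new u) → ∃ λ i → T (mover i) × pos s′ i ≡ u
      new⇐mover u nu with to T-∧ nu
      ... | unprot , occ with occupied-elim (pos s′) occ
      ...   | i , at-u with moved-or-stayed step i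
      ...     | inj₁ (_ , used+1) = i , fromWitness used+1 , at-u
      ...     | inj₂ (stayed , _) =
        ⊥-elim (T-not⇒¬T unprot (occupied⇒prot u (occupied-intro (pos s) i (trans (sym stayed) at-u))))
      used′ : ∀ i → suc (used s′ i) ≡ suc (used s i) + ind (mover i)
      used′ i with moved-or-stayed step i
      ... | inj₁ (_ , used+1) = begin-equality
              suc (used s′ i)               ≡⟨ cong suc used+1 ⟩
              suc (suc (used s i))          ≡⟨ +-comm 1 _ ⟩
              suc (used s i) + 1            ≡⟨ cong (suc (used s i) +_) (sym (ind-true (fromWitness used+1))) ⟩
              suc (used s i) + ind (mover i) ∎
      ... | inj₂ (_ , same) = begin-equality
              suc (used s′ i)               ≡⟨ cong suc same ⟩
              suc (used s i)                ≡⟨ sym (+-identityʳ _) ⟩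
              suc (used s i) + 0            ≡⟨ cong (suc (used s i) +_) (sym (ind-false (1+n≢n ∘ sym ∘ trans (sym same) ∘ toWitness))) ⟩
              suc (used s i) + ind (mover i) ∎


  successful⇒n≤m*[1+k] : ∀ m (p : Fin m → Fin n) → Successful p → n ≤ m * suc k
  successful⇒n≤m*[1+k] m p (s , play , all-prot) = begin
    n                            ≡⟨ sym (count-all (prot s) all-prot) ⟩
    count (prot s)               ≤⟨ count-prot≤ ⟩
    ∑ (λ i → suc (used s i))     ≤⟨ ∑-mono _ _ (λ i → s≤s (used≤k i)) ⟩
    ∑ {m} (const (suc k))        ≡⟨ ∑-const m (suc k) ⟩
    m * suc k                    ∎
    where
      open ≤-Reasoning
      open Budgeted (invariant-along Budgeted budgeted-step play (budgeted-initial p))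

  module _ {m} (p : Fin m → Fin n) (inert : ∀ v → ¬ T (active (initial p) v)) where
    Unmoved : State n m → Set
    Unmoved s = (∀ i → pos s i ≡ p i) × (∀ i → used s i ≡ 0) × (∀ u → prot s u ≡ occupied p u)

    unmoved-active : ∀ {s} → Unmoved s → ∀ v → active s v ≡ active (initial p) v
    unmoved-active (pos≗p , used≗0 , prot≗occ) v = cong₂ (λ a b → (0 <ᵇ a) ∧ (a ≤ᵇ b))
      (count-cong (λ u → cong (λ b → G v u ∧ not b) (prot≗occ u)))
      (count-cong (λ i → cong₂ (λ w u → ⌊ w Fin.≟ v ⌋ ∧ (u <ᵇ k)) (pos≗p i) (used≗0 i)))

    unmoved-step : ∀ {s s′} → Step s s′ → Unmoved s → Unmoved s′
    unmoved-step {s} {s′} (_ , others , _ , prot′) U@(pos≗p , used≗0 , prot≗occ) = pos′≗p , used′≗0 , prot′≗occ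
      where
        stuck : ∀ i → T (not (canMove s i))
        stuck i = ¬T⇒T-not λ can → inert (pos s i) (subst T (unmoved-active U (pos s i)) (proj₂ (to (T-∧ {mobile s i}) can)))
        pos′≗p : ∀ i → pos s′ i ≡ p i
        pos′≗p i = trans (proj₁ (others i (stuck i))) (pos≗p i)
        used′≗0 : ∀ i → used s′ i ≡ 0
        used′≗0 i = trans (proj₂ (others i (stuck i))) (used≗0 i)
        prot′≗occ : ∀ u → prot s′ u ≡ occupied p u
        prot′≗occ u = begin
          prot s′ u                              ≡⟨ prot′ u ⟩
          prot s u ∨ occupied (pos s′) u         ≡⟨ cong₂ _∨_ (prot≗occ u) (cong (0 <ᵇ_) (count-cong (cong (λ w → ⌊ w Fin.≟ u ⌋) ∘ pos′≗p))) ⟩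
          occupied p u ∨ occupied p u            ≡⟨ ∨-idem (occupied p u) ⟩
          occupied p u                           ∎
          where open ≡-Reasoning


    inert⇒n≤m : Successful p → n ≤ m
    inert⇒n≤m (s , play , all-prot) = begin
      n                      ≡⟨ sym (count-all (occupied p) (λ u → subst T (prot≗occ u) (all-prot u))) ⟩
      count (occupied p)     ≤⟨ count-occupied≤ p ⟩
      m                      ∎
      where
        open ≤-Reasoning
        prot≗occ : ∀ u → prot s u ≡ occupied p u
        prot≗occ = proj₂ (proj₂ (invariant-along Unmoved unmoved-step play ((λ _ → refl) , (λ _ → refl) , (λ _ → refl))))

  module _ {m} (s : State n m) (moves : Fin m → Bool) (target : Fin m → Fin n) where
    advance : State n m
    advance = state pos′ used′ (λ u → prot s u ∨ occupied pos′ u)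
      where
        pos′ : Fin m → Fin n
        pos′ i = if moves i then target i else pos s i
        used′ : Fin m → ℕ
        used′ i = if moves i then suc (used s i) else used s i

    advance-mover : ∀ i → T (moves i) → pos advance i ≡ target i × used advance i ≡ suc (used s i)
    advance-mover i mv with moves i
    ... | true = refl , refl

    advance-stayer : ∀ i → ¬ T (moves i) → pos advance i ≡ pos s i × used advance i ≡ used s i
    advance-stayer i ¬mv with moves i
    ... | true = ⊥-elim (¬mv tt)
    ... | false = refl , refl

    advance-step : (∀ i → T (moves i) → T (canMove s i) × T (unprotNbr s (pos s i) (target i))) →
      (∀ v u → T (active s v) → T (unprotNbr s v u) → ∃ λ i → T (moves i) × pos s i ≡ v × target i ≡ u) →
      Step s advance
    advance-step legal covering = movers , others , covered , λ _ → refl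
      where
        movers : ∀ i → T (canMove s i) →
          (T (unprotNbr s (pos s i) (pos advance i)) × used advance i ≡ suc (used s i))
          ⊎ (pos advance i ≡ pos s i × used advance i ≡ used s i)
        movers i _ with moves i in eq
        ... | true = inj₁ (proj₂ (legal i (from T-≡ eq)) , refl)
        ... | false = inj₂ (refl , refl)
        others : ∀ i → T (not (canMove s i)) → pos advance i ≡ pos s i × used advance i ≡ used s i
        others i cannot = advance-stayer i (λ mv → T-not⇒¬T cannot (proj₁ (legal i mv)))
        covered : ∀ v u → T (active s v) → T (unprotNbr s v u) → ∃ λ i → pos s i ≡ v × T (mobile s i) × pos advance i ≡ u
        covered v u act vu with covering v u act vu
        ... | i , mv , at-v , to-u = i , at-v , proj₁ (to (T-∧ {mobile s i}) (proj₁ (legal i mv))) ,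
                                     trans (proj₁ (advance-mover i mv)) to-u

-- Paths and cycles

vertex : ∀ {n} x → .(x < n) → Fin n
vertex x x<n = Fin.fromℕ< x<n

toℕ-vertex : ∀ {n x} .{x<n : x < n} → toℕ (vertex x x<n) ≡ x
toℕ-vertex {x<n = x<n} = Finₚ.toℕ-fromℕ< x<n

Consecutive : ∀ {n} → Fin n → Fin n → Set
Consecutive v u = suc (toℕ v) ≡ toℕ u ⊎ suc (toℕ u) ≡ toℕ v

path-edge : ∀ {n} {v u : Fin n} → Consecutive v u → T (pathAdj n v u)
path-edge {v = v} {u} (inj₁ v+1≡u) = from (T-∨ {⌊ suc (toℕ v) ≟ toℕ u ⌋}) (inj₁ (fromWitness v+1≡u))
path-edge {v = v} {u} (inj₂ u+1≡v) = from (T-∨ {⌊ suc (toℕ v) ≟ toℕ u ⌋}) (inj₂ (fromWitness u+1≡v))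

path-edge⁻¹ : ∀ {n} {v u : Fin n} → T (pathAdj n v u) → Consecutive v u
path-edge⁻¹ {v = v} {u} vu with to (T-∨ {⌊ suc (toℕ v) ≟ toℕ u ⌋}) vu
... | inj₁ v+1≡u = inj₁ (toWitness v+1≡u)
... | inj₂ u+1≡v = inj₂ (toWitness u+1≡v)

cycle-edge : ∀ {n} {v u : Fin n} → Consecutive v u → T (cycleAdj n v u)
cycle-edge c = from T-∨ (inj₁ (path-edge c))

cycle-wrap-edge : ∀ {n} {v u : Fin n} → toℕ v ≡ 0 → toℕ u ≡ n ∸ 1 → T (cycleAdj n v u) × T (cycleAdj n u v)
cycle-wrap-edge {n} {v} {u} v≡0 u≡n-1 =
  from (T-∨ {pathAdj n v u}) (inj₂ (from T-∨ (inj₁ ends))) ,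
  from (T-∨ {pathAdj n u v}) (inj₂ (from (T-∨ {⌊ toℕ u ≟ 0 ⌋ ∧ ⌊ toℕ v ≟ n ∸ 1 ⌋}) (inj₂ ends)))
  where
    ends : T (⌊ toℕ v ≟ 0 ⌋ ∧ ⌊ toℕ u ≟ n ∸ 1 ⌋)
    ends = from (T-∧ {⌊ toℕ v ≟ 0 ⌋}) (fromWitness v≡0 , fromWitness u≡n-1)

cycle-edge⁻¹ : ∀ {n} {v u : Fin n} → T (cycleAdj n v u) → Consecutive v u ⊎ (toℕ u ≡ 0 ⊎ toℕ u ≡ n ∸ 1)
cycle-edge⁻¹ {n} {v} {u} vu with to (T-∨ {pathAdj n v u}) vu
... | inj₁ path = inj₁ (path-edge⁻¹ path)
... | inj₂ wrap with to (T-∨ {⌊ toℕ v ≟ 0 ⌋ ∧ ⌊ toℕ u ≟ n ∸ 1 ⌋}) wrap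
...   | inj₁ v0-un = inj₂ (inj₂ (toWitness (proj₂ (to (T-∧ {⌊ toℕ v ≟ 0 ⌋}) v0-un))))
...   | inj₂ u0-vn = inj₂ (inj₁ (toWitness (proj₁ (to (T-∧ {⌊ toℕ u ≟ 0 ⌋}) u0-vn))))

cycle-irreflexive : ∀ {n} → 2 ≤ n → (v : Fin n) → ¬ T (cycleAdj n v v)
cycle-irreflexive {n} 2≤n v vv with to (T-∨ {pathAdj n v v}) vv
... | inj₁ path = [ 1+n≢n , 1+n≢n ]′ (path-edge⁻¹ {v = v} path)
... | inj₂ wrap = ends-differ ([ id , id ]′ (to (T-∨ {⌊ toℕ v ≟ 0 ⌋ ∧ ⌊ toℕ v ≟ n ∸ 1 ⌋}) wrap))
  where
    ends-differ : ¬ T (⌊ toℕ v ≟ 0 ⌋ ∧ ⌊ toℕ v ≟ n ∸ 1 ⌋)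
    ends-differ both with to (T-∧ {⌊ toℕ v ≟ 0 ⌋}) both
    ... | v≡0 , v≡n-1 = <⇒≢ (∸-monoˡ-≤ 1 2≤n) (trans (sym (toWitness v≡0)) (toWitness v≡n-1))

cycle-neighbours : ∀ {n} → 3 ≤ n → (v : Fin n) → ∃ λ a → ∃ λ b → a ≢ b × T (cycleAdj n v a) × T (cycleAdj n v b)
cycle-neighbours {n} 3≤n v = neighbours (toℕ v) refl (Finₚ.toℕ<n v)
  where
    Neighbours : Set
    Neighbours = ∃ λ a → ∃ λ b → a ≢ b × T (cycleAdj n v a) × T (cycleAdj n v b)
    two : ∀ a b → toℕ a ≢ toℕ b → T (cycleAdj n v a) → T (cycleAdj n v b) → Neighbours
    two a b a≢b va vb = a , b , a≢b ∘ cong toℕ , va , vb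
    neighbours : ∀ x → toℕ v ≡ x → x < n → Neighbours
    neighbours zero v≡0 _ = two a b (λ a≡b → <⇒≢ 1<n-1 (trans (sym ta) (trans a≡b tb)))
        (cycle-edge {v = v} {u = a} (inj₁ (trans (cong suc v≡0) (sym ta))))
        (proj₁ (cycle-wrap-edge {v = v} {u = b} v≡0 tb))
      where
        1<n-1 : 1 < n ∸ 1
        1<n-1 = ∸-monoˡ-≤ 1 3≤n
        a b : Fin n
        a = vertex 1 (≤-trans (s≤s (s≤s z≤n)) 3≤n)
        b = vertex (n ∸ 1) (∸-monoʳ-< (s≤s z≤n) (≤-trans (s≤s z≤n) 3≤n))
        ta : toℕ a ≡ 1
        ta = toℕ-vertex
        tb : toℕ b ≡ n ∸ 1
        tb = toℕ-vertex
    neighbours (suc y) v≡y+1 y+1<n with suc (suc y) <? n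
    ... | yes y+2<n = two a b (λ a≡b → <⇒≢ (<-trans (n<1+n y) (n<1+n (suc y))) (trans (sym ta) (trans a≡b tb)))
          (cycle-edge {v = v} {u = a} (inj₂ (trans (cong suc ta) (sym v≡y+1))))
          (cycle-edge {v = v} {u = b} (inj₁ (trans (cong suc v≡y+1) (sym tb))))
      where
        a b : Fin n
        a = vertex y (<-trans (n<1+n y) y+1<n)
        b = vertex (suc (suc y)) y+2<n
        ta : toℕ a ≡ y
        ta = toℕ-vertex
        tb : toℕ b ≡ suc (suc y)
        tb = toℕ-vertex
    ... | no y+2≮n = two a b (λ a≡b → 1+n≰n (subst (3 ≤_) (trans n≡y+2 (cong (2 +_) (trans (sym ta) (trans a≡b tb)))) 3≤n))
          (cycle-edge {v = v} {u = a} (inj₂ (trans (cong suc ta) (sym v≡y+1))))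
          (proj₂ (cycle-wrap-edge {v = b} {u = v} tb (trans v≡y+1 (cong (_∸ 1) (sym n≡y+2)))))
      where
        n≡y+2 : n ≡ suc (suc y)
        n≡y+2 = ≤-antisym (≮⇒≥ y+2≮n) y+1<n
        a b : Fin n
        a = vertex y (<-trans (n<1+n y) y+1<n)
        b = vertex 0 (≤-trans (s≤s z≤n) y+1<n)
        ta : toℕ a ≡ y
        ta = toℕ-vertex
        tb : toℕ b ≡ 0
        tb = toℕ-vertex

-- Lower bounds

module CompleteLower (k n : ℕ) where
  open Game k (completeAdj n)
  open GameProperties k (completeAdj n)

  -- An active vertex hosts at least one searcher per unoccupied vertex, and every
  -- other occupied vertex hosts a searcher as well.
  inert-if-1+m<n : ∀ {m} → suc m < n → (p : Fin m → Fin n) → ∀ v → ¬ T (active (initial p) v)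
  inert-if-1+m<n {m} 1+m<n p v act = <⇒≱ 1+m<n (begin
    n                                        ≡⟨ sym (count-complement (occupied p)) ⟩
    count (occupied p) + count unoccupied    ≤⟨ +-mono-≤ occupied≤ unoccupied≤ ⟩
    suc (count (not ∘ at-v)) + count at-v     ≡⟨ cong suc (+-comm (count (not ∘ at-v)) _) ⟩
    suc (count at-v + count (not ∘ at-v))     ≡⟨ cong suc (count-complement at-v) ⟩
    suc m                                    ∎)
    where
      open ≤-Reasoning
      s₀ : State n m
      s₀ = initial p
      unoccupied : Fin n → Bool
      unoccupied u = not (occupied p u)
      at-v : Fin m → Bool
      at-v i = ⌊ p i Fin.≟ v ⌋
      v-occupied : T (occupied p v)
      v-occupied = let i , pi≡v , _ = active-elim {s = s₀} act in occupied-intro p i pi≡v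
      unoccupied≤ : count unoccupied ≤ count at-v
      unoccupied≤ = begin
        count unoccupied               ≤⟨ count-mono unoccupied (unprotNbr s₀ v) unoccupied⇒nbr ⟩
        count (unprotNbr s₀ v)         ≤⟨ proj₂ (active-counts {s = s₀} act) ⟩
        count (mobileAt s₀ v)          ≤⟨ count-mono (mobileAt s₀ v) at-v (λ i → proj₁ ∘ to T-∧) ⟩
        count at-v                     ∎
        where
          unoccupied⇒nbr : ∀ u → T (unoccupied u) → T (unprotNbr s₀ v u)
          unoccupied⇒nbr u unocc = from T-∧
            (fromWitnessFalse (λ v≡u → T-not⇒¬T unocc (subst (T ∘ occupied p) v≡u v-occupied)) , unocc)
      occupied≤ : count (occupied p) ≤ suc (count (not ∘ at-v))
      occupied≤ = ≤-trans (count-insert (occupied p) elsewhere v split)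
                          (s≤s (count-image elsewhere (not ∘ at-v) p cover))
        where
          elsewhere : Fin n → Bool
          elsewhere u = occupied p u ∧ not ⌊ v Fin.≟ u ⌋
          split : ∀ u → T (occupied p u) → u ≡ v ⊎ T (elsewhere u)
          split u occ with v Fin.≟ u
          ... | yes v≡u = inj₁ (sym v≡u)
          ... | no _ = inj₂ (from T-∧ (occ , tt))
          cover : ∀ u → T (elsewhere u) → ∃ λ i → T (not (at-v i)) × p i ≡ u
          cover u el with to T-∧ el
          ... | occ , v≢u with occupied-elim p occ
          ...   | i , pi≡u = i , fromWitnessFalse (λ pi≡v → toWitnessFalse v≢u (trans (sym pi≡v) pi≡u)) , pi≡u

  lower-bound : ∀ m (p : Fin m → Fin n) → Successful p → n ∸ 1 ≤ m
  lower-bound m p success = ≮⇒≥ λ m<n-1 →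
    <⇒≱ (1+m<n m<n-1) (≤-trans (inert⇒n≤m p (inert-if-1+m<n (1+m<n m<n-1) p) success) (n≤1+n m))
    where
      1+m<n : m < n ∸ 1 → suc m < n
      1+m<n m<n-1 = subst (_≤ n) (+-comm (suc m) 1)
        (m≤o∸n⇒m+n≤o (suc m) (≤-trans (s≤s z≤n) (≤-trans m<n-1 (m∸n≤m n 1))) m<n-1)

module CycleLower (k n : ℕ) (3≤n : 3 ≤ n) where
  open Game k (cycleAdj n)
  open GameProperties k (cycleAdj n)

  single-searcher-inert : (p : Fin 1 → Fin n) → ∀ v → ¬ T (active (initial p) v)
  single-searcher-inert p v act =
    <⇒≱ (≤-trans two-unprotected (proj₂ (active-counts {s = s₀} act))) (count≤1 (mobileAt s₀ v) zero only-zero)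
    where
      s₀ : State n 1
      s₀ = initial p
      only-zero : (i : Fin 1) → T (mobileAt s₀ v i) → i ≡ zero
      only-zero zero _ = refl
      p0≡v : p zero ≡ v
      p0≡v with active-elim {s = s₀} act
      ... | zero , p0≡v , _ = p0≡v
      only-v : ∀ {u} → T (occupied p u) → v ≡ u
      only-v occ with occupied-elim p occ
      ... | zero , p0≡u = trans (sym p0≡v) p0≡u
      unprotected : ∀ u → T (cycleAdj n v u) → T (unprotNbr s₀ v u)
      unprotected u vu = from T-∧ (vu , ¬T⇒T-not λ occ → cycle-irreflexive (≤-trans (n≤1+n 2) 3≤n) v
        (subst (T ∘ cycleAdj n v) (sym (only-v occ)) vu))
      two-unprotected : 2 ≤ count (unprotNbr s₀ v)
      two-unprotected with cycle-neighbours 3≤n v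
      ... | a , b , a≢b , va , vb = count≥2 _ a b (unprotected a va) (unprotected b vb) a≢b

  lower-bound : ∀ m (p : Fin m → Fin n) → Successful p → 2 ≤ m
  lower-bound zero p success = ⊥-elim (<⇒≱ 3≤n (≤-trans (successful⇒n≤m*[1+k] zero p success) z≤n))
  lower-bound (suc zero) p success = ⊥-elim (<⇒≱ 3≤n (≤-trans (inert⇒n≤m p (single-searcher-inert p) success) (n≤1+n 1)))
  lower-bound (suc (suc m)) _ _ = s≤s (s≤s z≤n)

-- Upper bounds

module CompleteUpper (k : ℕ) (0<k : 0 < k) (n : ℕ) where
  open Game k (completeAdj (suc (suc n)))
  open GameProperties k (completeAdj (suc (suc n)))

  layout : Fin (suc n) → Fin (suc (suc n))
  layout = Fin.inject₁

  last : Fin (suc (suc n))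
  last = Fin.fromℕ (suc n)

  s₀ : State (suc (suc n)) (suc n)
  s₀ = initial layout

  others-occupied : ∀ u → u ≢ last → T (occupied layout u)
  others-occupied u u≢last = occupied-intro layout (Fin.lower₁ u n≢u) (Finₚ.inject₁-lower₁ u n≢u)
    where
      n≢u : suc n ≢ toℕ u
      n≢u n≡u = u≢last (Finₚ.toℕ-injective (trans (sym n≡u) (sym (Finₚ.toℕ-fromℕ (suc n)))))

  last-unoccupied : ¬ T (occupied layout last)
  last-unoccupied occ = let i , i≡last = occupied-elim layout occ in Finₚ.fromℕ≢inject₁ (sym i≡last)

  unprotected⇒last : ∀ v u → T (unprotNbr s₀ v u) → u ≡ last
  unprotected⇒last v u vu with u Fin.≟ last
  ... | yes u≡last = u≡last
  ... | no u≢last = ⊥-elim (T-not⇒¬T (proj₂ (to (T-∧ {completeAdj _ v u}) vu)) (others-occupied u u≢last))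

  last-unprotected-nbr : ∀ i → T (unprotNbr s₀ (layout i) last)
  last-unprotected-nbr i = from T-∧
    (fromWitnessFalse (λ i≡last → Finₚ.fromℕ≢inject₁ (sym i≡last)) , ¬T⇒T-not last-unoccupied)

  s₁ : State (suc (suc n)) (suc n)
  s₁ = advance s₀ (const true) (const last)

  step : Step s₀ s₁
  step = advance-step s₀ (const true) (const last) legal covering
    where
      legal : ∀ i → T true → T (canMove s₀ i) × T (unprotNbr s₀ (layout i) last)
      legal i _ = from T-∧ (<⇒<ᵇ 0<k , active-intro {s = s₀} i refl (<⇒<ᵇ 0<k) (last-unprotected-nbr i) (unprotected⇒last _))
                , last-unprotected-nbr i
      covering : ∀ v u → T (active s₀ v) → T (unprotNbr s₀ v u) → ∃ λ i → T true × layout i ≡ v × last ≡ u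
      covering v u act vu = let i , at-v , _ = active-elim {s = s₀} act in i , tt , at-v , sym (unprotected⇒last v u vu)

  successful : Successful layout
  successful = s₁ , step ◅ ε , all-protected
    where
      all-protected : ∀ u → T (prot s₁ u)
      all-protected u with u Fin.≟ last
      ... | yes u≡last = from (T-∨ {occupied layout u}) (inj₂ (occupied-intro {m = suc n} (const last) zero (sym u≡last)))
      ... | no u≢last = from T-∨ (inj₁ (others-occupied u u≢last))

module LoneWalker (k n : ℕ) (0<n : 0 < n) (n≤1+k : n ≤ suc k) where
  open Game k (pathAdj n)
  open GameProperties k (pathAdj n)

  record Walked (t : ℕ) (s : State n 1) : Set where
    field
      pos≡t : toℕ (pos s zero) ≡ t
      used≡t : used s zero ≡ t
      prot⇒≤t : ∀ u → T (prot s u) → toℕ u ≤ t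
      ≤t⇒prot : ∀ u → toℕ u ≤ t → T (prot s u)

  layout : Fin 1 → Fin n
  layout _ = vertex 0 0<n

  walked-initial : Walked 0 (initial layout)
  walked-initial = record
    { pos≡t = toℕ-vertex
    ; used≡t = refl
    ; prot⇒≤t = λ u occ → ≤-reflexive (trans (sym (cong toℕ (proj₂ (occupied-elim layout occ)))) toℕ-vertex)
    ; ≤t⇒prot = λ u u≤0 → occupied-intro layout zero (Finₚ.toℕ-injective (trans toℕ-vertex (sym (n≤0⇒n≡0 u≤0))))
    }

  walk-step : ∀ {t s} → Walked t s → (t+1<n : suc t < n) → ∃ λ s′ → Step s s′ × Walked (suc t) s′
  walk-step {t} {s} W t+1<n = s′ , advance-step s (const true) (const next) legal covering , walked′
    where
      open Walked W
      next : Fin n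
      next = vertex (suc t) t+1<n
      here : Fin n
      here = pos s zero
      next-unprotected : T (unprotNbr s here next)
      next-unprotected = from T-∧
        ( path-edge (inj₁ (trans (cong suc pos≡t) (sym toℕ-vertex)))
        , ¬T⇒T-not (λ p → 1+n≰n (subst (_≤ t) toℕ-vertex (prot⇒≤t next p))))
      only-next : ∀ w → T (unprotNbr s here w) → w ≡ next
      only-next w hw with to (T-∧ {pathAdj n here w}) hw
      ... | edge , unprot with path-edge⁻¹ edge
      ...   | inj₁ t+1≡w = Finₚ.toℕ-injective (trans (sym t+1≡w) (trans (cong suc pos≡t) (sym toℕ-vertex)))
      ...   | inj₂ w+1≡t = ⊥-elim (T-not⇒¬T unprot (≤t⇒prot w (≤-trans (n≤1+n _) (≤-reflexive (trans w+1≡t pos≡t)))))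
      mobile₀ : T (mobile s zero)
      mobile₀ = <⇒<ᵇ (subst (_< k) (sym used≡t) (≤-pred (≤-trans t+1<n n≤1+k)))
      legal : ∀ i → T true → T (canMove s i) × T (unprotNbr s (pos s i) next)
      legal zero _ = from T-∧ (mobile₀ , active-intro {s = s} zero refl mobile₀ next-unprotected only-next) , next-unprotected
      covering : ∀ v u → T (active s v) → T (unprotNbr s v u) → ∃ λ i → T true × pos s i ≡ v × next ≡ u
      covering v u act vu with active-elim {s = s} act
      ... | zero , here≡v , _ = zero , tt , here≡v , sym (only-next u (subst (λ x → T (unprotNbr s x u)) (sym here≡v) vu))
      s′ : State n 1
      s′ = advance s (const true) (const next)
      walked′ : Walked (suc t) s′
      walked′ = record
        { pos≡t = toℕ-vertex
        ; used≡t = cong suc used≡t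
        ; prot⇒≤t = prot⇒≤t+1
        ; ≤t⇒prot = ≤t+1⇒prot
        }
        where
          prot⇒≤t+1 : ∀ u → T (prot s′ u) → toℕ u ≤ suc t
          prot⇒≤t+1 u p′ with to (T-∨ {prot s u}) p′
          ... | inj₁ p = ≤-trans (prot⇒≤t u p) (n≤1+n t)
          ... | inj₂ occ = ≤-reflexive (trans (cong toℕ (sym (proj₂ (occupied-elim (pos s′) occ)))) toℕ-vertex)
          ≤t+1⇒prot : ∀ u → toℕ u ≤ suc t → T (prot s′ u)
          ≤t+1⇒prot u u≤t+1 with m≤n⇒m<n∨m≡n u≤t+1
          ... | inj₁ u<t+1 = from T-∨ (inj₁ (≤t⇒prot u (≤-pred u<t+1)))
          ... | inj₂ u≡t+1 = from (T-∨ {prot s u}) (inj₂ (occupied-intro (pos s′) zero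
                               (Finₚ.toℕ-injective (trans toℕ-vertex (sym u≡t+1)))))

  walk : ∀ r {t s} → Walked t s → r + suc t ≡ n → ∃ λ s′ → Star Step s s′ × (∀ u → T (prot s′ u))
  walk zero {s = s} W t+1≡n = s , ε , λ u → Walked.≤t⇒prot W u (≤-pred (subst (toℕ u <_) (sym t+1≡n) (Finₚ.toℕ<n u)))
  walk (suc r) {t} W r+t+2≡n with walk-step W (subst (suc t <_) r+t+2≡n (s≤s (m≤n+m (suc t) r)))
  ... | s′ , step , W′ with walk r W′ (trans (+-suc r (suc t)) r+t+2≡n)
  ...   | s″ , steps , done = s″ , step ◅ steps , done

  successful : Successful layout
  successful = walk (n ∸ 1) walked-initial (m∸n+n≡m 0<n)

budget-shift : ∀ {k q q′ a a′ t} → a′ + q ≡ a + q′ → a + t ≤ suc (k + q) → a′ + t ≤ suc (k + q′)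
budget-shift {k} {q} {q′} {a} {a′} {t} shift within = +-cancelʳ-≤ q (a′ + t) (suc (k + q′)) (begin
  a′ + t + q          ≡⟨ xy∙z≈xz∙y a′ t q ⟩
  a′ + q + t          ≡⟨ cong (_+ t) shift ⟩
  a + q′ + t          ≡⟨ xy∙z≈xz∙y a q′ t ⟩
  a + t + q′          ≤⟨ +-monoˡ-≤ q′ within ⟩
  suc (k + q) + q′    ≡⟨ cong suc (xy∙z≈xz∙y k q q′) ⟩
  suc (k + q′) + q    ∎)
  where open ≤-Reasoning

-- Searchers 0, ..., c - 1 start at P 0, ..., P (c - 1) and searcher c at n - 1;
-- the edges of G other than those of the path lead to 0 or n - 1.
module Sweep (k n : ℕ) (G : Adj n) (c : ℕ) (P : ℕ → ℕ) (2≤n : 2 ≤ n) (0<c : 0 < c)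
  (path-edges : ∀ {v u} → Consecutive v u → T (G v u))
  (edges : ∀ {v u} → T (G v u) → Consecutive v u ⊎ (toℕ u ≡ 0 ⊎ toℕ u ≡ n ∸ 1))
  (P0≡0 : P 0 ≡ 0)
  (P-spaced : ∀ j → suc j < c → 2 + P j ≤ P (suc j))
  (P-reachable : ∀ j → suc j < c → P (suc j) ≤ suc (k + P j))
  (P-clear : ∀ j → 0 < j → j < c → 2 + P j ≤ n ∸ suc k)
  (last-reaches : n ∸ suc k ≤ suc (k + P (c ∸ 1)))
  where

  open Game k G
  open GameProperties k G

  -- The back searcher can protect the vertices from R on.
  R : ℕ
  R = n ∸ suc k

  0<n : 0 < n
  0<n = ≤-trans (s≤s z≤n) 2≤n

  P-increasing : ∀ {j j′} → j < j′ → j′ < c → 2 + P j ≤ P j′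
  P-increasing {j} {suc j′} (s≤s j≤j′) j′+1<c with m≤n⇒m<n∨m≡n j≤j′
  ... | inj₂ refl = P-spaced j j′+1<c
  ... | inj₁ j<j′ = ≤-trans (P-increasing j<j′ (<-trans (n<1+n j′) j′+1<c))
                            (≤-trans (m≤n+m (P j′) 2) (P-spaced j′ j′+1<c))

  P-apart : ∀ {j j′} → j < c → j′ < c → j ≢ j′ → 2 + P j ≤ P j′ ⊎ 2 + P j′ ≤ P j
  P-apart j<c j′<c j≢j′ with <-cmp _ _
  ... | tri< j<j′ _ _ = inj₁ (P-increasing j<j′ j′<c)
  ... | tri≈ _ j≡j′ _ = ⊥-elim (j≢j′ j≡j′)
  ... | tri> _ _ j′<j = inj₂ (P-increasing j′<j j<c)

  P-not-adjacent : ∀ {j j′} → j < c → j′ < c → P j′ ≢ suc (P j)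
  P-not-adjacent {j} {j′} j<c j′<c Pj′≡1+Pj with j ≟ j′
  ... | yes refl = 1+n≢n (sym Pj′≡1+Pj)
  ... | no j≢j′ with P-apart j<c j′<c j≢j′
  ...   | inj₁ 2+Pj≤Pj′ = 1+n≰n (subst (2 + P j ≤_) Pj′≡1+Pj 2+Pj≤Pj′)
  ...   | inj₂ 2+Pj′≤Pj =
    1+n≰n (≤-trans (n≤1+n _) (≤-trans (n≤1+n _) (subst (λ x → 2 + x ≤ P j) Pj′≡1+Pj 2+Pj′≤Pj)))

  P-injective : ∀ {j j′} → j < c → j′ < c → P j ≡ P j′ → j ≡ j′
  P-injective {j} {j′} j<c j′<c Pj≡Pj′ with j ≟ j′
  ... | yes j≡j′ = j≡j′
  ... | no j≢j′ = ⊥-elim ([ (λ h → 1+n≰n (≤-trans (n≤1+n _) (subst (2 + P j ≤_) (sym Pj≡Pj′) h)))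
                          , (λ h → 1+n≰n (≤-trans (n≤1+n _) (subst (λ x → 2 + x ≤ P j) (sym Pj≡Pj′) h))) ]′
                          (P-apart j<c j′<c j≢j′))

  -- Searcher f is responsible for the vertices below target f.
  target : ℕ → ℕ
  target f with suc f <? c
  ... | yes _ = P (suc f)
  ... | no _ = R

  target-next : ∀ {f} → suc f < c → target f ≡ P (suc f)
  target-next {f} f+1<c with suc f <? c
  ... | yes f+1<c′ = refl
  ... | no f+1≮c = ⊥-elim (f+1≮c f+1<c)

  target-last : ∀ {f} → ¬ suc f < c → target f ≡ R
  target-last {f} f+1≮c with suc f <? c
  ... | yes f+1<c = ⊥-elim (f+1≮c f+1<c)
  ... | no f+1≮c′ = refl

  target-reachable : ∀ f → f < c → target f ≤ suc (k + P f)
  target-reachable f f<c with suc f <? c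
  ... | yes f+1<c = P-reachable f f+1<c
  ... | no f+1≮c = subst (λ j → R ≤ suc (k + P j)) (cong (_∸ 1) (≤-antisym (≮⇒≥ f+1≮c) f<c)) last-reaches

  P<n : ∀ j → j < c → P j < n
  P<n zero _ = subst (_< n) (sym P0≡0) 0<n
  P<n (suc j) j+1<c = ≤-trans (n≤1+n _) (≤-trans (P-clear (suc j) (s≤s z≤n) j+1<c) (m∸n≤m n (suc k)))

  n-1<n : n ∸ 1 < n
  n-1<n = ≤-reflexive (suc[n∸1]≡n 0<n)

  layout : Fin (suc c) → Fin n
  layout i with toℕ i <? c
  ... | yes i<c = vertex (P (toℕ i)) (P<n (toℕ i) i<c)
  ... | no _ = vertex (n ∸ 1) n-1<n

  layout-chain : ∀ i → toℕ i < c → toℕ (layout i) ≡ P (toℕ i)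
  layout-chain i i<c with toℕ i <? c
  ... | yes _ = toℕ-vertex
  ... | no i≮c = ⊥-elim (i≮c i<c)

  layout-back : ∀ i → toℕ i ≡ c → toℕ (layout i) ≡ n ∸ 1
  layout-back i i≡c with toℕ i <? c
  ... | yes i<c = ⊥-elim (<-irrefl i≡c i<c)
  ... | no _ = toℕ-vertex

  Fresh : ℕ → ℕ → Set
  Fresh f x = ∃ λ j → f < j × j < c × P j ≡ x

  Covered : ℕ → ℕ → ℕ → ℕ → Set
  Covered f q b x = x ≤ q ⊎ b ≤ x ⊎ Fresh f x

  data Role (f : ℕ) (i : Fin (suc c)) : Set where
    done : toℕ i < f → Role f i
    front : toℕ i ≡ f → Role f i
    fresh : f < toℕ i → toℕ i < c → Role f i
    back : toℕ i ≡ c → Role f i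

  role : ∀ f (i : Fin (suc c)) → Role f i
  role f i with <-cmp (toℕ i) f | toℕ i ≟ c
  ... | tri< i<f _ _ | _ = done i<f
  ... | tri≈ _ i≡f _ | _ = front i≡f
  ... | tri> _ _ f<i | yes i≡c = back i≡c
  ... | tri> _ _ f<i | no i≢c = fresh f<i (≤∧≢⇒< (≤-pred (Finₚ.toℕ<n i)) i≢c)

  -- Searchers below f are done, f is the front at q, those between f and c have not
  -- moved, and c is at b.  The protected vertices are those up to q, those from b on,
  -- and the starting points of the searchers that have not moved.
  record Invariant (s : State n (suc c)) : Set where
    field
      f q b : ℕ
      f<c : f < c
      R≤b : R ≤ b
      covered⇒prot : ∀ u → Covered f q b (toℕ u) → T (prot s u)
      prot⇒covered : ∀ u → T (prot s u) → Covered f q b (toℕ u)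
      done-pos : ∀ i → toℕ i < f → toℕ (pos s i) < q
      front-pos : ∀ i → toℕ i ≡ f → toℕ (pos s i) ≡ q
      front-used≤k : ∀ i → toℕ i ≡ f → used s i ≤ k
      front-budget : ∀ i → toℕ i ≡ f → used s i + target f ≤ suc (k + q)
      fresh-pos : ∀ i → f < toℕ i → toℕ i < c → toℕ (pos s i) ≡ P (toℕ i)
      fresh-unused : ∀ i → f < toℕ i → toℕ i < c → used s i ≡ 0
      back-pos : ∀ i → toℕ i ≡ c → toℕ (pos s i) ≡ b
      back-used : ∀ i → toℕ i ≡ c → used s i + suc b ≡ n
      q<next : suc f < c → q < P (suc f)

    remaining : ℕ
    remaining = b ∸ q

  -- The vertex right of the front is not the starting point of its successor.
  Normalised : ∀ {s} → Invariant s → Set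
  Normalised I = suc f < c → 2 + q ≤ P (suc f)
    where open Invariant I

  s₀ : State n (suc c)
  s₀ = initial layout

  initial-invariant : Σ (Invariant s₀) Normalised
  initial-invariant = I₀ , λ 1<c → subst (λ x → 2 + x ≤ P 1) P0≡0 (P-spaced 0 1<c)
    where
      chain-at : ∀ u j (j<c : j < c) → P j ≡ toℕ u → T (occupied layout u)
      chain-at u j j<c Pj≡u = occupied-intro layout (vertex j (<-trans j<c (n<1+n c)))
        (Finₚ.toℕ-injective (trans (layout-chain _ (subst (_< c) (sym toℕ-vertex) j<c))
                                   (trans (cong P toℕ-vertex) Pj≡u)))
      covered⇒occupied : ∀ u → Covered 0 0 (n ∸ 1) (toℕ u) → T (occupied layout u)
      covered⇒occupied u (inj₁ u≤0) = chain-at u 0 0<c (trans P0≡0 (sym (n≤0⇒n≡0 u≤0)))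
      covered⇒occupied u (inj₂ (inj₁ n-1≤u)) = occupied-intro layout (Fin.fromℕ c)
        (Finₚ.toℕ-injective (trans (layout-back _ (Finₚ.toℕ-fromℕ c))
                                   (≤-antisym n-1≤u (<⇒≤∸1 (Finₚ.toℕ<n u)))))
      covered⇒occupied u (inj₂ (inj₂ (j , _ , j<c , Pj≡u))) = chain-at u j j<c Pj≡u
      occupied⇒covered : ∀ u → T (occupied layout u) → Covered 0 0 (n ∸ 1) (toℕ u)
      occupied⇒covered u occ with occupied-elim layout occ
      ... | i , i↦u with role 0 i
      ...   | front i≡0 = inj₁ (≤-reflexive (trans (cong toℕ (sym i↦u))
                  (trans (layout-chain i (subst (_< c) (sym i≡0) 0<c)) (trans (cong P i≡0) P0≡0))))
      ...   | fresh 0<i i<c = inj₂ (inj₂ (toℕ i , 0<i , i<c , trans (sym (layout-chain i i<c)) (cong toℕ i↦u)))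
      ...   | back i≡c = inj₂ (inj₁ (≤-reflexive (trans (sym (layout-back i i≡c)) (cong toℕ i↦u))))
      I₀ : Invariant s₀
      I₀ = record
        { f = 0 ; q = 0 ; b = n ∸ 1
        ; f<c = 0<c
        ; R≤b = ∸-monoʳ-≤ n (s≤s z≤n)
        ; covered⇒prot = covered⇒occupied
        ; prot⇒covered = occupied⇒covered
        ; done-pos = λ _ ()
        ; front-pos = λ i i≡0 → trans (layout-chain i (subst (_< c) (sym i≡0) 0<c)) (trans (cong P i≡0) P0≡0)
        ; front-used≤k = λ _ _ → z≤n
        ; front-budget = λ _ _ → subst (λ x → target 0 ≤ suc (k + x)) P0≡0 (target-reachable 0 0<c)
        ; fresh-pos = λ i _ i<c → layout-chain i i<c
        ; fresh-unused = λ _ _ _ → refl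
        ; back-pos = layout-back
        ; back-used = λ _ _ → suc[n∸1]≡n 0<n
        ; q<next = λ 1<c → subst (_< P 1) P0≡0 (≤-trans (n≤1+n _) (P-spaced 0 1<c))
        }

  finished : ∀ {s} (I : Invariant s) → Invariant.b I ≤ suc (Invariant.q I) → ∀ u → T (prot s u)
  finished I b≤q+1 u with toℕ u ≤? Invariant.q I
  ... | yes u≤q = Invariant.covered⇒prot I u (inj₁ u≤q)
  ... | no u≰q = Invariant.covered⇒prot I u (inj₂ (inj₁ (≤-trans b≤q+1 (≰⇒> u≰q))))

  hand-over : ∀ {s} (I : Invariant s) → let open Invariant I in suc f < c → P (suc f) ≡ suc q →
    Σ (Invariant s) λ I′ → Normalised I′ × Invariant.remaining I′ ≤ remaining
  hand-over {s} I f+1<c next≡q+1 = I′ , normalised , ∸-monoʳ-≤ b (n≤1+n q)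
    where
      open Invariant I
      next-fresh : Fresh f (suc q)
      next-fresh = suc f , ≤-refl , f+1<c , next≡q+1
      covered⇒prot′ : ∀ u → Covered (suc f) (suc q) b (toℕ u) → T (prot s u)
      covered⇒prot′ u (inj₁ u≤q+1) with m≤n⇒m<n∨m≡n u≤q+1
      ... | inj₁ u<q+1 = covered⇒prot u (inj₁ (≤-pred u<q+1))
      ... | inj₂ u≡q+1 = covered⇒prot u (inj₂ (inj₂ (subst (Fresh f) (sym u≡q+1) next-fresh)))
      covered⇒prot′ u (inj₂ (inj₁ b≤u)) = covered⇒prot u (inj₂ (inj₁ b≤u))
      covered⇒prot′ u (inj₂ (inj₂ (j , f+1<j , j<c , Pj≡u))) =
        covered⇒prot u (inj₂ (inj₂ (j , <-trans (n<1+n f) f+1<j , j<c , Pj≡u)))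
      prot⇒covered′ : ∀ u → T (prot s u) → Covered (suc f) (suc q) b (toℕ u)
      prot⇒covered′ u p with prot⇒covered u p
      ... | inj₁ u≤q = inj₁ (≤-trans u≤q (n≤1+n q))
      ... | inj₂ (inj₁ b≤u) = inj₂ (inj₁ b≤u)
      ... | inj₂ (inj₂ (j , f<j , j<c , Pj≡u)) with j ≟ suc f
      ...   | yes refl = inj₁ (≤-reflexive (trans (sym Pj≡u) next≡q+1))
      ...   | no j≢f+1 = inj₂ (inj₂ (j , ≤∧≢⇒< f<j (j≢f+1 ∘ sym) , j<c , Pj≡u))
      room : suc (suc f) < c → 2 + suc q ≤ P (suc (suc f))
      room f+2<c = subst (λ x → 2 + x ≤ P (suc (suc f))) next≡q+1 (P-spaced (suc f) f+2<c)
      next-searcher : ∀ i → toℕ i ≡ suc f → toℕ (pos s i) ≡ suc q × used s i ≡ 0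
      next-searcher i i≡f+1 = trans (fresh-pos i f<i i<c) (trans (cong P i≡f+1) next≡q+1) , fresh-unused i f<i i<c
        where
          f<i : f < toℕ i
          f<i = ≤-reflexive (sym i≡f+1)
          i<c : toℕ i < c
          i<c = subst (_< c) (sym i≡f+1) f+1<c
      I′ : Invariant s
      I′ = record
        { f = suc f ; q = suc q ; b = b
        ; f<c = f+1<c
        ; R≤b = R≤b
        ; covered⇒prot = covered⇒prot′
        ; prot⇒covered = prot⇒covered′
        ; done-pos = λ i i<f+1 → [ (λ i<f → ≤-trans (done-pos i i<f) (n≤1+n q)) , (λ i≡f → s≤s (≤-reflexive (front-pos i i≡f))) ]′
                                   (m≤n⇒m<n∨m≡n (≤-pred i<f+1))
        ; front-pos = λ i i≡f+1 → proj₁ (next-searcher i i≡f+1)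
        ; front-used≤k = λ i i≡f+1 → subst (_≤ k) (sym (proj₂ (next-searcher i i≡f+1))) z≤n
        ; front-budget = λ i i≡f+1 → subst (λ u → u + target (suc f) ≤ suc (k + suc q)) (sym (proj₂ (next-searcher i i≡f+1)))
                                       (subst (λ x → target (suc f) ≤ suc (k + x)) next≡q+1 (target-reachable (suc f) f+1<c))
        ; fresh-pos = λ i f+1<i → fresh-pos i (<-trans (n<1+n f) f+1<i)
        ; fresh-unused = λ i f+1<i → fresh-unused i (<-trans (n<1+n f) f+1<i)
        ; back-pos = back-pos
        ; back-used = back-used
        ; q<next = λ f+2<c → ≤-trans (n≤1+n _) (room f+2<c)
        }
      normalised : Normalised I′
      normalised = room

  normalise : ∀ {s} (I : Invariant s) →
    Σ (Invariant s) λ I′ → Normalised I′ × Invariant.remaining I′ ≤ Invariant.remaining I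
  normalise I with suc (Invariant.f I) <? c
  ... | no f+1≮c = I , (λ f+1<c → ⊥-elim (f+1≮c f+1<c)) , ≤-refl
  ... | yes f+1<c with 2 + Invariant.q I ≤? P (suc (Invariant.f I))
  ...   | yes room = I , (λ _ → room) , ≤-refl
  ...   | no no-room = hand-over I f+1<c (≤-antisym (≮⇒≥ no-room) (Invariant.q<next I f+1<c))

  module Stage {s : State n (suc c)} (I : Invariant s) (normalised : Normalised I)
               (gap : 2 + Invariant.q I ≤ Invariant.b I) where
    open Invariant I

    iF iB : Fin (suc c)
    iF = vertex f (<-trans f<c (n<1+n c))
    iB = Fin.fromℕ c

    iF-unique : ∀ {i} → toℕ i ≡ f → i ≡ iF
    iF-unique i≡f = Finₚ.toℕ-injective (trans i≡f (sym toℕ-vertex))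

    iB-unique : ∀ {i} → toℕ i ≡ c → i ≡ iB
    iB-unique i≡c = Finₚ.toℕ-injective (trans i≡c (sym (Finₚ.toℕ-fromℕ c)))

    front-at-q : toℕ (pos s iF) ≡ q
    front-at-q = front-pos iF toℕ-vertex

    back-at-b : toℕ (pos s iB) ≡ b
    back-at-b = back-pos iB (Finₚ.toℕ-fromℕ c)

    b<n : b < n
    b<n = subst (_< n) back-at-b (Finₚ.toℕ<n (pos s iB))

    0<b : 0 < b
    0<b = ≤-trans (s≤s z≤n) gap

    vF vB : Fin n
    vF = vertex (suc q) (≤-trans gap (<⇒≤ b<n))
    vB = vertex (b ∸ 1) (≤-trans (≤-reflexive (suc[n∸1]≡n 0<b)) (<⇒≤ b<n))

    vF≡q+1 : toℕ vF ≡ suc q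
    vF≡q+1 = toℕ-vertex

    vB≡b-1 : toℕ vB ≡ b ∸ 1
    vB≡b-1 = toℕ-vertex

    fresh-ahead : ∀ {x} → Fresh f x → 2 + q ≤ x
    fresh-ahead (j , f<j , j<c , Pj≡x) with m≤n⇒m<n∨m≡n f<j
    ... | inj₂ refl = subst (2 + q ≤_) Pj≡x (normalised j<c)
    ... | inj₁ f+1<j = ≤-trans (normalised (<-trans f+1<j j<c))
                               (≤-trans (m≤n+m _ 2) (subst (2 + P (suc f) ≤_) Pj≡x (P-increasing f+1<j j<c)))

    fresh-behind : ∀ {x} → Fresh f x → 2 + x ≤ b
    fresh-behind (j , f<j , j<c , refl) = ≤-trans (P-clear j (≤-trans (s≤s z≤n) f<j) j<c) R≤b

    unprotected : ∀ u → q < toℕ u → toℕ u < b → ¬ Fresh f (toℕ u) → T (not (prot s u))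
    unprotected u q<u u<b not-fresh = ¬T⇒T-not λ p → case (prot⇒covered u p)
      where
        case : Covered f q b (toℕ u) → ⊥
        case (inj₁ u≤q) = <⇒≱ q<u u≤q
        case (inj₂ (inj₁ b≤u)) = <⇒≱ u<b b≤u
        case (inj₂ (inj₂ fresh-u)) = not-fresh fresh-u

    unprotected-nbr : ∀ {v u} → T (unprotNbr s v u) → Consecutive v u × q < toℕ u × toℕ u < b
    unprotected-nbr {v} {u} vu with to (T-∧ {G v u}) vu
    ... | edge , unprot with ≰⇒> (T-not⇒¬T unprot ∘ covered⇒prot u ∘ inj₁)
                           | ≰⇒> (T-not⇒¬T unprot ∘ covered⇒prot u ∘ inj₂ ∘ inj₁)
    ...   | q<u | u<b with edges edge
    ...     | inj₁ consecutive = consecutive , q<u , u<b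
    ...     | inj₂ (inj₁ u≡0) = ⊥-elim (<⇒≢ (≤-trans (s≤s z≤n) q<u) (sym u≡0))
    ...     | inj₂ (inj₂ u≡n-1) = ⊥-elim (<⇒≱ u<b (subst (b ≤_) (sym u≡n-1) (<⇒≤∸1 b<n)))

    vF-unprotected : T (not (prot s vF))
    vF-unprotected = unprotected vF (subst (q <_) (sym vF≡q+1) ≤-refl) (subst (_< b) (sym vF≡q+1) gap)
      (λ fresh → 1+n≰n (subst (2 + q ≤_) vF≡q+1 (fresh-ahead fresh)))

    vB-unprotected : T (not (prot s vB))
    vB-unprotected = unprotected vB (subst (q <_) (sym vB≡b-1) (2+m≤n⇒m<n∸1 gap))
      (subst (_< b) (sym vB≡b-1) (≤-reflexive (suc[n∸1]≡n 0<b)))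
      (λ fresh → 1+n≰n (subst (λ x → suc x ≤ b) (suc[n∸1]≡n 0<b) (subst (λ x → 2 + x ≤ b) vB≡b-1 (fresh-behind fresh))))

    front-nbr : T (unprotNbr s (pos s iF) vF)
    front-nbr = from T-∧ (path-edges (inj₁ (trans (cong suc front-at-q) (sym vF≡q+1))) , vF-unprotected)

    front-nbr-unique : ∀ u → T (unprotNbr s (pos s iF) u) → u ≡ vF
    front-nbr-unique u hu with unprotected-nbr hu
    ... | inj₁ q+1≡u , _ = Finₚ.toℕ-injective (trans (sym q+1≡u) (trans (cong suc front-at-q) (sym vF≡q+1)))
    ... | inj₂ u+1≡q , q<u , _ = ⊥-elim (<⇒≱ q<u (≤-trans (n≤1+n _) (≤-reflexive (trans u+1≡q front-at-q))))

    back-nbr : T (unprotNbr s (pos s iB) vB)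
    back-nbr = from T-∧ (path-edges (inj₂ (trans (cong suc vB≡b-1) (trans (suc[n∸1]≡n 0<b) (sym back-at-b)))) , vB-unprotected)

    back-nbr-unique : ∀ u → T (unprotNbr s (pos s iB) u) → u ≡ vB
    back-nbr-unique u hu with unprotected-nbr hu
    ... | inj₁ b+1≡u , _ , u<b = ⊥-elim (<⇒≱ u<b (≤-trans (n≤1+n _) (≤-reflexive (trans (sym (cong suc back-at-b)) b+1≡u))))
    ... | inj₂ u+1≡b , _ = Finₚ.toℕ-injective (trans (cong (_∸ 1) (trans u+1≡b back-at-b)) (sym vB≡b-1))

    front-can-move : T (mobile s iF) → T (canMove s iF)
    front-can-move mob = from T-∧ (mob , active-intro {s = s} iF refl mob front-nbr front-nbr-unique)

    back-can-move : T (mobile s iB) → T (canMove s iB)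
    back-can-move mob = from T-∧ (mob , active-intro {s = s} iB refl mob back-nbr back-nbr-unique)

    module _ (i : Fin (suc c)) (f<i : f < toℕ i) (i<c : toℕ i < c) where
      private
        x : ℕ
        x = P (toℕ i)
        at-x : toℕ (pos s i) ≡ x
        at-x = fresh-pos i f<i i<c
        2+q≤x : 2 + q ≤ x
        2+q≤x = fresh-ahead (toℕ i , f<i , i<c , refl)
        2+x≤b : 2 + x ≤ b
        2+x≤b = fresh-behind (toℕ i , f<i , i<c , refl)
        0<x : 0 < x
        0<x = ≤-trans (s≤s z≤n) 2+q≤x
        x-1<b : x ∸ 1 < b
        x-1<b = ≤-trans (≤-reflexive (suc[n∸1]≡n 0<x)) (≤-trans (n≤1+n x) (≤-trans (n≤1+n _) 2+x≤b))
        left right : Fin n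
        left = vertex (x ∸ 1) (<-trans x-1<b b<n)
        right = vertex (suc x) (<-trans 2+x≤b b<n)
        left-unprotected : T (unprotNbr s (pos s i) left)
        left-unprotected = from T-∧
          ( path-edges (inj₂ (trans (cong suc toℕ-vertex) (trans (suc[n∸1]≡n 0<x) (sym at-x))))
          , unprotected left
              (subst (q <_) (sym toℕ-vertex) (2+m≤n⇒m<n∸1 2+q≤x))
              (subst (_< b) (sym toℕ-vertex) x-1<b)
              (λ { (j , _ , j<c , Pj≡x-1) →
                   P-not-adjacent j<c i<c (trans (sym (suc[n∸1]≡n 0<x)) (cong suc (sym (trans Pj≡x-1 toℕ-vertex)))) }))
        right-unprotected : T (unprotNbr s (pos s i) right)
        right-unprotected = from T-∧
          ( path-edges (inj₁ (trans (cong suc at-x) (sym toℕ-vertex)))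
          , unprotected right
              (subst (q <_) (sym toℕ-vertex) (≤-trans (n≤1+n _) (≤-trans 2+q≤x (n≤1+n x))))
              (subst (_< b) (sym toℕ-vertex) 2+x≤b)
              (λ { (j , _ , j<c , Pj≡x+1) → P-not-adjacent i<c j<c (trans Pj≡x+1 toℕ-vertex) }))

      fresh-two-unprotected : 2 ≤ count (unprotNbr s (pos s i))
      fresh-two-unprotected = count≥2 _ left right left-unprotected right-unprotected
        (λ l≡r → <⇒≢ (≤-trans (≤-reflexive (suc[n∸1]≡n 0<x)) (n≤1+n x))
                     (trans (sym toℕ-vertex) (trans (cong toℕ l≡r) toℕ-vertex)))

      fresh-alone : ∀ i′ → pos s i′ ≡ pos s i → i′ ≡ i
      fresh-alone i′ same with role f i′ | trans (cong toℕ same) at-x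
      ... | done i′<f | i′-at-x = ⊥-elim (<⇒≱ (done-pos i′ i′<f)
              (≤-trans (n≤1+n _) (≤-trans (≤-trans (n≤1+n _) 2+q≤x) (≤-reflexive (sym i′-at-x)))))
      ... | front i′≡f | i′-at-x = ⊥-elim (1+n≰n (≤-trans (n≤1+n _)
              (subst (2 + q ≤_) (trans (sym i′-at-x) (front-pos i′ i′≡f)) 2+q≤x)))
      ... | fresh f<i′ i′<c | i′-at-x = Finₚ.toℕ-injective (P-injective i′<c i<c (trans (sym (fresh-pos i′ f<i′ i′<c)) i′-at-x))
      ... | back i′≡c | i′-at-x = ⊥-elim (1+n≰n (≤-trans (n≤1+n _)
              (subst (2 + x ≤_) (trans (sym (back-pos i′ i′≡c)) i′-at-x) 2+x≤b)))

      fresh-inert : ¬ T (active s (pos s i))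
      fresh-inert act = <⇒≱ (≤-trans fresh-two-unprotected (proj₂ (active-counts {s = s} act)))
                            (count≤1 _ i (λ i′ at → fresh-alone i′ (mobileAt⇒at {s = s} i′ at)))

    is-front is-back : Fin (suc c) → Bool
    is-front i = ⌊ toℕ i ≟ f ⌋
    is-back i = ⌊ toℕ i ≟ c ⌋

    moves : Fin (suc c) → Bool
    moves i = canMove s i ∧ (is-front i ∨ is-back i)

    dest : Fin (suc c) → Fin n
    dest i = if is-front i then vF else vB

    moves-front : moves iF ≡ canMove s iF
    moves-front with toℕ iF ≟ f
    ... | yes _ = ∧-identityʳ _
    ... | no iF≢f = ⊥-elim (iF≢f toℕ-vertex)

    moves-back : moves iB ≡ canMove s iB
    moves-back with toℕ iB ≟ f | toℕ iB ≟ c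
    ... | yes _ | _ = ∧-identityʳ _
    ... | no _ | yes _ = ∧-identityʳ _
    ... | no _ | no iB≢c = ⊥-elim (iB≢c (Finₚ.toℕ-fromℕ c))

    moves-other : ∀ i → toℕ i ≢ f → toℕ i ≢ c → ¬ T (moves i)
    moves-other i i≢f i≢c mv with to (T-∨ {is-front i}) (proj₂ (to (T-∧ {canMove s i}) mv))
    ... | inj₁ i-front = i≢f (toWitness i-front)
    ... | inj₂ i-back = i≢c (toWitness i-back)

    dest-front : dest iF ≡ vF
    dest-front with toℕ iF ≟ f
    ... | yes _ = refl
    ... | no iF≢f = ⊥-elim (iF≢f toℕ-vertex)

    dest-back : dest iB ≡ vB
    dest-back with toℕ iB ≟ f
    ... | yes iB≡f = ⊥-elim (<-irrefl (trans (sym iB≡f) (Finₚ.toℕ-fromℕ c)) f<c)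
    ... | no _ = refl

    mover-role : ∀ i → T (moves i) → i ≡ iF ⊎ i ≡ iB
    mover-role i mv with toℕ i ≟ f | toℕ i ≟ c
    ... | yes i≡f | _ = inj₁ (iF-unique i≡f)
    ... | no _ | yes i≡c = inj₂ (iB-unique i≡c)
    ... | no _ | no _ = ⊥-elim (proj₂ (to (T-∧ {canMove s i}) mv))

    legal : ∀ i → T (moves i) → T (canMove s i) × T (unprotNbr s (pos s i) (dest i))
    legal i mv with mover-role i mv
    ... | inj₁ refl = subst T moves-front mv , subst (T ∘ unprotNbr s (pos s iF)) (sym dest-front) front-nbr
    ... | inj₂ refl = subst T moves-back mv , subst (T ∘ unprotNbr s (pos s iB)) (sym dest-back) back-nbr

    covering : ∀ v u → T (active s v) → T (unprotNbr s v u) → ∃ λ i → T (moves i) × pos s i ≡ v × dest i ≡ u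
    covering v u act vu with active-elim {s = s} act
    ... | i , i-at-v , mob with role f i | unprotected-nbr vu
    ...   | done i<f | consecutive , q<u , _ = ⊥-elim (<⇒≱ q<u (neighbour-bound consecutive))
      where
        neighbour-bound : Consecutive v u → toℕ u ≤ q
        neighbour-bound (inj₁ v+1≡u) = ≤-trans (≤-reflexive (sym v+1≡u)) (subst (λ w → toℕ w < q) i-at-v (done-pos i i<f))
        neighbour-bound (inj₂ u+1≡v) = ≤-trans (n≤1+n _) (≤-trans (≤-reflexive u+1≡v) (subst (λ w → toℕ w ≤ q) i-at-v (<⇒≤ (done-pos i i<f))))
    ...   | front i≡f | _ with iF-unique i≡f
    ...     | refl = iF , subst T (sym moves-front) (front-can-move mob) , i-at-v ,
                     trans dest-front (sym (front-nbr-unique u (subst (λ w → T (unprotNbr s w u)) (sym i-at-v) vu)))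
    covering v u act vu | i , i-at-v , mob | fresh f<i i<c | _ =
      ⊥-elim (fresh-inert i f<i i<c (subst (T ∘ active s) (sym i-at-v) act))
    covering v u act vu | i , i-at-v , mob | back i≡c | _ with iB-unique i≡c
    ... | refl = iB , subst T (sym moves-back) (back-can-move mob) , i-at-v ,
                 trans dest-back (sym (back-nbr-unique u (subst (λ w → T (unprotNbr s w u)) (sym i-at-v) vu)))

    s′ : State n (suc c)
    s′ = advance s moves dest

    step : Step s s′
    step = advance-step s moves dest legal covering

    record FrontOutcome (q′ : ℕ) : Set where
      field
        q≤q′ : q ≤ q′
        q′≤1+q : q′ ≤ suc q
        at-q′ : toℕ (pos s′ iF) ≡ q′
        used-shift : used s′ iF + q ≡ used s iF + q′
        used≤k : used s′ iF ≤ k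
        moved : T (canMove s iF) → q′ ≡ suc q

    front-outcome : Σ ℕ FrontOutcome
    front-outcome with canMove s iF in eq
    ... | true = suc q , record
      { q≤q′ = n≤1+n q
      ; q′≤1+q = ≤-refl
      ; at-q′ = trans (cong toℕ (trans pos′ dest-front)) vF≡q+1
      ; used-shift = trans (cong (_+ q) used′) (sym (+-suc _ q))
      ; used≤k = subst (_≤ k) (sym used′) (<ᵇ⇒< _ _ (proj₁ (to (T-∧ {mobile s iF}) can)))
      ; moved = λ _ → refl
      }
      where
        can : T (canMove s iF)
        can = from T-≡ eq
        pos′ : pos s′ iF ≡ dest iF
        pos′ = proj₁ (advance-mover s moves dest iF (subst T (sym moves-front) can))
        used′ : used s′ iF ≡ suc (used s iF)
        used′ = proj₂ (advance-mover s moves dest iF (subst T (sym moves-front) can))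
    ... | false = q , record
      { q≤q′ = ≤-refl
      ; q′≤1+q = n≤1+n q
      ; at-q′ = trans (cong toℕ pos′) front-at-q
      ; used-shift = cong (_+ q) used′
      ; used≤k = subst (_≤ k) (sym used′) (front-used≤k iF toℕ-vertex)
      ; moved = λ can → ⊥-elim (subst T eq can)
      }
      where
        stays : ¬ T (moves iF)
        stays mv = subst T (trans moves-front eq) mv
        pos′ : pos s′ iF ≡ pos s iF
        pos′ = proj₁ (advance-stayer s moves dest iF stays)
        used′ : used s′ iF ≡ used s iF
        used′ = proj₂ (advance-stayer s moves dest iF stays)

    record BackOutcome (b′ : ℕ) : Set where
      field
        b′≤b : b′ ≤ b
        b≤1+b′ : b ≤ suc b′
        R≤b′ : R ≤ b′
        at-b′ : toℕ (pos s′ iB) ≡ b′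
        used-b′ : used s′ iB + suc b′ ≡ n
        moved : T (canMove s iB) → suc b′ ≡ b

    back-outcome : Σ ℕ BackOutcome
    back-outcome with canMove s iB in eq
    ... | true = b ∸ 1 , record
      { b′≤b = m∸n≤m b 1
      ; b≤1+b′ = ≤-reflexive (sym (suc[n∸1]≡n 0<b))
      ; R≤b′ = R≤b-1
      ; at-b′ = trans (cong toℕ (trans pos′ dest-back)) vB≡b-1
      ; used-b′ = trans (cong₂ _+_ used′ (suc[n∸1]≡n 0<b)) (trans (sym (+-suc _ b)) (back-used iB (Finₚ.toℕ-fromℕ c)))
      ; moved = λ _ → suc[n∸1]≡n 0<b
      }
      where
        can : T (canMove s iB)
        can = from T-≡ eq
        pos′ : pos s′ iB ≡ dest iB
        pos′ = proj₁ (advance-mover s moves dest iB (subst T (sym moves-back) can))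
        used′ : used s′ iB ≡ suc (used s iB)
        used′ = proj₂ (advance-mover s moves dest iB (subst T (sym moves-back) can))
        R≤b-1 : R ≤ b ∸ 1
        R≤b-1 = begin
          n ∸ suc k                         ≡⟨ cong (_∸ suc k) (sym (back-used iB (Finₚ.toℕ-fromℕ c))) ⟩
          (used s iB + suc b) ∸ suc k       ≡⟨ cong (_∸ suc k) (+-suc _ b) ⟩
          (suc (used s iB) + b) ∸ suc k     ≤⟨ ∸-monoˡ-≤ (suc k) (+-monoˡ-≤ b (<ᵇ⇒< (used s iB) k (proj₁ (to (T-∧ {mobile s iB}) can)))) ⟩
          (k + b) ∸ suc k                   ≡⟨ [k+b]∸[1+k]≡b∸1 k b ⟩
          b ∸ 1                             ∎
          where open ≤-Reasoning
    ... | false = b , record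
      { b′≤b = ≤-refl
      ; b≤1+b′ = n≤1+n b
      ; R≤b′ = R≤b
      ; at-b′ = trans (cong toℕ pos′) back-at-b
      ; used-b′ = trans (cong (_+ suc b) used′) (back-used iB (Finₚ.toℕ-fromℕ c))
      ; moved = λ can → ⊥-elim (subst T eq can)
      }
      where
        stays : ¬ T (moves iB)
        stays mv = subst T (trans moves-back eq) mv
        pos′ : pos s′ iB ≡ pos s iB
        pos′ = proj₁ (advance-stayer s moves dest iB stays)
        used′ : used s′ iB ≡ used s iB
        used′ = proj₂ (advance-stayer s moves dest iB stays)

    unchanged : ∀ i → toℕ i ≢ f → toℕ i ≢ c → pos s′ i ≡ pos s i × used s′ i ≡ used s i
    unchanged i i≢f i≢c = advance-stayer s moves dest i (moves-other i i≢f i≢c)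

    next-invariant : ∀ {q′ b′} → FrontOutcome q′ → BackOutcome b′ → Invariant s′
    next-invariant {q′} {b′} F B = record
      { f = f ; q = q′ ; b = b′
      ; f<c = f<c
      ; R≤b = R≤b′
      ; covered⇒prot = covered⇒prot′
      ; prot⇒covered = prot⇒covered′
      ; done-pos = λ i i<f → <-≤-trans (done-below i i<f) q≤q′
      ; front-pos = front-at-q′
      ; front-used≤k = λ i i≡f → subst (λ j → used s′ j ≤ k) (sym (iF-unique i≡f)) F.used≤k
      ; front-budget = λ i i≡f → subst (λ j → used s′ j + target f ≤ suc (k + q′)) (sym (iF-unique i≡f))
                                   (budget-shift {k = k} {q = q} {a = used s iF} used-shift (front-budget iF toℕ-vertex))
      ; fresh-pos = λ i f<i i<c → trans (cong toℕ (proj₁ (fresh-unchanged i f<i i<c))) (fresh-pos i f<i i<c)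
      ; fresh-unused = λ i f<i i<c → trans (proj₂ (fresh-unchanged i f<i i<c)) (fresh-unused i f<i i<c)
      ; back-pos = back-at-b′
      ; back-used = λ i i≡c → subst (λ j → used s′ j + suc b′ ≡ n) (sym (iB-unique i≡c)) used-b′
      ; q<next = λ f+1<c → ≤-trans (s≤s q′≤1+q) (normalised f+1<c)
      }
      where
        open FrontOutcome F
        open BackOutcome B
        module F = FrontOutcome F
        done-below : ∀ i → toℕ i < f → toℕ (pos s′ i) < q
        done-below i i<f = subst (λ w → toℕ w < q) (sym (proj₁ (unchanged i (<⇒≢ i<f) (<⇒≢ (<-trans i<f f<c)))))
                                 (done-pos i i<f)
        front-at-q′ : ∀ i → toℕ i ≡ f → toℕ (pos s′ i) ≡ q′
        front-at-q′ i i≡f = subst (λ j → toℕ (pos s′ j) ≡ q′) (sym (iF-unique i≡f)) at-q′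
        fresh-unchanged : ∀ i → f < toℕ i → toℕ i < c → pos s′ i ≡ pos s i × used s′ i ≡ used s i
        fresh-unchanged i f<i i<c = unchanged i (<⇒≢ f<i ∘ sym) (<⇒≢ i<c)
        back-at-b′ : ∀ i → toℕ i ≡ c → toℕ (pos s′ i) ≡ b′
        back-at-b′ i i≡c = subst (λ j → toℕ (pos s′ j) ≡ b′) (sym (iB-unique i≡c)) at-b′
        new-front : ∀ {u} → q′ ≡ toℕ u → T (prot s′ u)
        new-front q′≡u = from (T-∨ {prot s _}) (inj₂ (occupied-intro (pos s′) iF (Finₚ.toℕ-injective (trans at-q′ q′≡u))))
        new-back : ∀ {u} → b′ ≡ toℕ u → T (prot s′ u)
        new-back b′≡u = from (T-∨ {prot s _}) (inj₂ (occupied-intro (pos s′) iB (Finₚ.toℕ-injective (trans at-b′ b′≡u))))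
        covered⇒prot′ : ∀ u → Covered f q′ b′ (toℕ u) → T (prot s′ u)
        covered⇒prot′ u (inj₁ u≤q′) with toℕ u ≤? q
        ... | yes u≤q = from T-∨ (inj₁ (covered⇒prot u (inj₁ u≤q)))
        ... | no u≰q = new-front (≤-antisym (≤-trans q′≤1+q (≰⇒> u≰q)) u≤q′)
        covered⇒prot′ u (inj₂ (inj₁ b′≤u)) with b ≤? toℕ u
        ... | yes b≤u = from T-∨ (inj₁ (covered⇒prot u (inj₂ (inj₁ b≤u))))
        ... | no b≰u = new-back (≤-antisym b′≤u (≤-pred (≤-trans (≰⇒> b≰u) b≤1+b′)))
        covered⇒prot′ u (inj₂ (inj₂ fresh-u)) = from T-∨ (inj₁ (covered⇒prot u (inj₂ (inj₂ fresh-u))))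
        prot⇒covered′ : ∀ u → T (prot s′ u) → Covered f q′ b′ (toℕ u)
        prot⇒covered′ u p′ with to (T-∨ {prot s u}) p′
        ... | inj₁ p with prot⇒covered u p
        ...   | inj₁ u≤q = inj₁ (≤-trans u≤q q≤q′)
        ...   | inj₂ (inj₁ b≤u) = inj₂ (inj₁ (≤-trans b′≤b b≤u))
        ...   | inj₂ (inj₂ fresh-u) = inj₂ (inj₂ fresh-u)
        prot⇒covered′ u p′ | inj₂ occ with occupied-elim (pos s′) occ
        ... | i , i-at-u with role f i | cong toℕ i-at-u
        ...   | done i<f | i≡u = inj₁ (≤-trans (<⇒≤ (subst (_< q) i≡u (done-below i i<f))) q≤q′)
        ...   | front i≡f | i≡u = inj₁ (≤-reflexive (trans (sym i≡u) (front-at-q′ i i≡f)))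
        ...   | fresh f<i i<c | i≡u = inj₂ (inj₂ (toℕ i , f<i , i<c ,
                  trans (sym (fresh-pos i f<i i<c)) (trans (cong toℕ (sym (proj₁ (fresh-unchanged i f<i i<c)))) i≡u)))
        ...   | back i≡c | i≡u = inj₂ (inj₁ (≤-reflexive (trans (sym (back-at-b′ i i≡c)) i≡u)))

    -- Were both exhausted, their budgets would already cover everything from q to b.
    someone-moves : T (canMove s iF) ⊎ T (canMove s iB)
    someone-moves with canMove s iF in front-eq | canMove s iB in back-eq
    ... | true | _ = inj₁ tt
    ... | false | true = inj₂ tt
    ... | false | false = ⊥-elim (<⇒≱ gap (≤-trans b≤R R≤q+1))
      where
        front-exhausted : used s iF ≡ k
        front-exhausted = ≤-antisym (front-used≤k iF toℕ-vertex)
          (≮⇒≥ λ used<k → subst T front-eq (front-can-move (<⇒<ᵇ used<k)))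
        back-exhausted : k ≤ used s iB
        back-exhausted = ≮⇒≥ λ used<k → subst T back-eq (back-can-move (<⇒<ᵇ used<k))
        target≤q+1 : target f ≤ suc q
        target≤q+1 = +-cancelˡ-≤ k (target f) (suc q)
          (subst₂ _≤_ (cong (_+ target f) front-exhausted) (sym (+-suc k q)) (front-budget iF toℕ-vertex))
        R≤q+1 : R ≤ suc q
        R≤q+1 with suc f <? c
        ... | yes f+1<c = ⊥-elim (1+n≰n (≤-trans (normalised f+1<c) (subst (_≤ suc q) (target-next f+1<c) target≤q+1)))
        ... | no f+1≮c = subst (_≤ suc q) (target-last f+1≮c) target≤q+1
        b≤R : b ≤ R
        b≤R = m+n≤o⇒m≤o∸n b (begin
          b + suc k              ≡⟨ +-comm b (suc k) ⟩
          suc (k + b)            ≡⟨ sym (+-suc k b) ⟩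
          k + suc b              ≤⟨ +-monoˡ-≤ (suc b) back-exhausted ⟩
          used s iB + suc b      ≡⟨ back-used iB (Finₚ.toℕ-fromℕ c) ⟩
          n                      ∎)
          where open ≤-Reasoning

    next-stage : ∃ λ s′ → Step s s′ × Σ (Invariant s′) λ I′ → Invariant.remaining I′ < remaining
    next-stage with front-outcome | back-outcome
    ... | q′ , F | b′ , B = s′ , step , next-invariant F B , decreases someone-moves
      where
        open FrontOutcome F renaming (moved to front-moved)
        open BackOutcome B renaming (moved to back-moved)
        decreases : T (canMove s iF) ⊎ T (canMove s iB) → b′ ∸ q′ < b ∸ q
        decreases (inj₁ front-can) = begin-strict
          b′ ∸ q′         ≡⟨ cong (b′ ∸_) (front-moved front-can) ⟩
          b′ ∸ suc q      ≤⟨ ∸-monoˡ-≤ (suc q) b′≤b ⟩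
          b ∸ suc q       <⟨ ∸-monoʳ-< (n<1+n q) (≤-trans (n≤1+n _) gap) ⟩
          b ∸ q           ∎
          where open ≤-Reasoning
        decreases (inj₂ back-can) = begin-strict
          b′ ∸ q′         ≤⟨ ∸-monoʳ-≤ b′ q≤q′ ⟩
          b′ ∸ q          <⟨ ∸-monoˡ-< (≤-reflexive (back-moved back-can)) q≤b′ ⟩
          b ∸ q           ∎
          where
            open ≤-Reasoning
            q≤b′ : q ≤ b′
            q≤b′ = ≤-pred (≤-trans (n≤1+n _) (≤-trans gap (≤-reflexive (sym (back-moved back-can)))))

  sweep : ∀ N {s} (I : Invariant s) → Normalised I → Invariant.remaining I ≤ N →
    ∃ λ s′ → Star Step s s′ × (∀ u → T (prot s′ u))
  sweep N {s} I normalised remaining≤N with Invariant.b I ≤? suc (Invariant.q I)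
  ... | yes b≤q+1 = s , ε , finished I b≤q+1
  ... | no b≰q+1 with Stage.next-stage I normalised (≰⇒> b≰q+1) | N
  ...   | _ , _ , _ , decreased | zero = ⊥-elim (<⇒≱ decreased (≤-trans remaining≤N z≤n))
  ...   | s′ , step , I′ , decreased | suc N′ with normalise I′
  ...     | I″ , normalised″ , no-increase with sweep N′ I″ normalised″ (≤-pred (≤-trans (s≤s no-increase) (≤-trans decreased remaining≤N)))
  ...       | s″ , steps , all-protected = s″ , step ◅ steps , all-protected

  successful : Successful layout
  successful = let I₀ , normalised₀ = initial-invariant in sweep _ I₀ normalised₀ ≤-refl

n≤ceilDiv*[1+k] : ∀ n k → n ≤ ceilDiv n k * suc k
n≤ceilDiv*[1+k] n k = +-cancelʳ-≤ k n (ceilDiv n k * suc k) (begin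
  n + k                                      ≡⟨ m≡m%n+[m/n]*n (n + k) (suc k) ⟩
  (n + k) % suc k + ceilDiv n k * suc k      ≤⟨ +-monoˡ-≤ _ (≤-pred (m%n<n (n + k) (suc k))) ⟩
  k + ceilDiv n k * suc k                    ≡⟨ +-comm k _ ⟩
  ceilDiv n k * suc k + k                    ∎)
  where open ≤-Reasoning

ceilDiv-least : ∀ n k m → n ≤ m * suc k → ceilDiv n k ≤ m
ceilDiv-least n k m n≤m[1+k] = ≤-pred (m<n*o⇒m/o<n (begin-strict
  n + k              ≤⟨ +-monoˡ-≤ k n≤m[1+k] ⟩
  m * suc k + k      <⟨ +-monoʳ-< (m * suc k) ≤-refl ⟩
  m * suc k + suc k  ≡⟨ +-comm (m * suc k) (suc k) ⟩
  suc m * suc k      ∎))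
  where open ≤-Reasoning

[ceilDiv∸1]*[1+k]<n : ∀ n k → 0 < n → (ceilDiv n k ∸ 1) * suc k < n
[ceilDiv∸1]*[1+k]<n n k 0<n = begin-strict
  (ceilDiv n k ∸ 1) * suc k          ≡⟨ *-distribʳ-∸ (suc k) (ceilDiv n k) 1 ⟩
  ceilDiv n k * suc k ∸ (1 * suc k)  ≤⟨ ∸-monoˡ-≤ (1 * suc k) (m/n*n≤m (n + k) (suc k)) ⟩
  (n + k) ∸ suc (k + 0)              ≡⟨ cong (λ x → (n + k) ∸ suc x) (+-identityʳ k) ⟩
  (n + k) ∸ suc k                    ≡⟨ cong (_∸ suc k) (+-comm n k) ⟩
  (k + n) ∸ suc k                    ≡⟨ [k+b]∸[1+k]≡b∸1 k n ⟩
  n ∸ 1                              <⟨ ≤-reflexive (suc[n∸1]≡n 0<n) ⟩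
  n                                  ∎
  where open ≤-Reasoning

module Spacing (k n c : ℕ) (2≤k : 2 ≤ k) (0<c : 0 < c)
  (n≤[1+c]*[1+k] : n ≤ suc c * suc k) (2≤c⇒c*[1+k]<n : 2 ≤ c → c * suc k < n) where

  X : ℕ
  X = (n ∸ suc k) ∸ 2

  -- Multiples of k + 1, capped two below the range of the back searcher.
  P : ℕ → ℕ
  P j = (j * suc k) ⊓ X

  2+j*[1+k]≤X : ∀ j → suc j < c → 2 + j * suc k ≤ X
  2+j*[1+k]≤X j j+1<c = m+n≤o⇒m≤o∸n (2 + j * suc k) (m+n≤o⇒m≤o∸n (2 + j * suc k + 2) (begin
    2 + j * suc k + 2 + suc k     ≡⟨ solve 2 (λ j k → con 2 :+ j :* (con 1 :+ k) :+ con 2 :+ (con 1 :+ k)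
                                                  := con 4 :+ (con 1 :+ j) :* (con 1 :+ k)) refl j k ⟩
    4 + suc j * suc k             ≤⟨ +-monoˡ-≤ (suc j * suc k) (s≤s (s≤s 2≤k)) ⟩
    suc ((2 + j) * suc k)         ≤⟨ s≤s (*-monoˡ-≤ (suc k) j+1<c) ⟩
    suc (c * suc k)               ≤⟨ 2≤c⇒c*[1+k]<n (≤-trans (s≤s (s≤s z≤n)) j+1<c) ⟩
    n                             ∎))
    where
      open ≤-Reasoning
      open +-*-Solver

  P-spaced : ∀ j → suc j < c → 2 + P j ≤ P (suc j)
  P-spaced j j+1<c = ⊓-glb (≤-trans 2+Pj≤2+jK (+-monoˡ-≤ (j * suc k) (≤-trans 2≤k (n≤1+n k))))
                           (≤-trans 2+Pj≤2+jK (2+j*[1+k]≤X j j+1<c))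
    where
      2+Pj≤2+jK : 2 + P j ≤ 2 + j * suc k
      2+Pj≤2+jK = +-monoʳ-≤ 2 (m⊓n≤m _ X)

  P-reachable : ∀ j → P (suc j) ≤ suc (k + P j)
  P-reachable j = begin
    (suc k + j * suc k) ⊓ X             ≤⟨ ⊓-monoʳ-≤ (suc k + j * suc k) (m≤n+m X (suc k)) ⟩
    (suc k + j * suc k) ⊓ (suc k + X)   ≡⟨ sym (+-distribˡ-⊓ (suc k) (j * suc k) X) ⟩
    suc k + P j                         ∎
    where open ≤-Reasoning

  P-clear : ∀ j → 0 < j → j < c → 2 + P j ≤ n ∸ suc k
  P-clear j 0<j j<c = begin
    2 + P j                     ≤⟨ +-monoʳ-≤ 2 (m⊓n≤n _ X) ⟩
    2 + (n ∸ suc k ∸ 2)         ≡⟨ m+[n∸m]≡n 2≤n-K ⟩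
    n ∸ suc k                   ∎
    where
      open ≤-Reasoning
      2≤n-K : 2 ≤ n ∸ suc k
      2≤n-K = ≤-trans (2+j*[1+k]≤X 0 (≤-trans (s≤s 0<j) j<c)) (m∸n≤m (n ∸ suc k) 2)

  last-reaches : n ∸ suc k ≤ suc (k + P (c ∸ 1))
  last-reaches = begin
    n ∸ suc k                                        ≤⟨ ⊓-glb ≤cK ≤K+X ⟩
    (suc k + (c ∸ 1) * suc k) ⊓ (suc k + X)          ≡⟨ sym (+-distribˡ-⊓ (suc k) ((c ∸ 1) * suc k) X) ⟩
    suc k + P (c ∸ 1)                                ∎
    where
      open ≤-Reasoning
      ≤cK : n ∸ suc k ≤ suc k + (c ∸ 1) * suc k
      ≤cK = m≤n+o⇒m∸n≤o n (suc k) (subst (λ x → n ≤ suc k + x * suc k) (sym (suc[n∸1]≡n 0<c)) n≤[1+c]*[1+k])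
      ≤K+X : n ∸ suc k ≤ suc k + X
      ≤K+X = ≤-trans (m≤n+m∸n (n ∸ suc k) 2) (+-monoˡ-≤ X (≤-trans 2≤k (n≤1+n k)))

module UpperBounds (k : ℕ) (2≤k : 2 ≤ k) where

  chain-sweep : ∀ {n} (G : Adj n) c →
    (∀ {v u} → Consecutive v u → T (G v u)) →
    (∀ {v u} → T (G v u) → Consecutive v u ⊎ (toℕ u ≡ 0 ⊎ toℕ u ≡ n ∸ 1)) →
    2 ≤ n → 0 < c → n ≤ suc c * suc k → (2 ≤ c → c * suc k < n) →
    Σ (Fin (suc c) → Fin n) (Game.Successful k G)
  chain-sweep {n} G c path-edges edges 2≤n 0<c n≤[1+c]*[1+k] 2≤c⇒c*[1+k]<n = S.layout , S.successful
    where
      module L = Spacing k n c 2≤k 0<c n≤[1+c]*[1+k] 2≤c⇒c*[1+k]<n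
      module S = Sweep k n G c L.P 2≤n 0<c path-edges edges refl
                       L.P-spaced (λ j _ → L.P-reachable j) L.P-clear L.last-reaches

  path-layout : ∀ n → 2 ≤ n → Σ (Fin (ceilDiv n k) → Fin n) (Game.Successful k (pathAdj n))
  path-layout n 2≤n = searchers (ceilDiv n k) (n≤ceilDiv*[1+k] n k) ([ceilDiv∸1]*[1+k]<n n k (≤-trans (s≤s z≤n) 2≤n))
    where
      searchers : ∀ d → n ≤ d * suc k → (d ∸ 1) * suc k < n → Σ (Fin d → Fin n) (Game.Successful k (pathAdj n))
      searchers zero n≤0 _ = ⊥-elim (<⇒≱ 2≤n (≤-trans n≤0 z≤n))
      searchers (suc zero) n≤1+k _ = W.layout , W.successful
        where module W = LoneWalker k n (≤-trans (s≤s z≤n) 2≤n) (subst (n ≤_) (+-identityʳ (suc k)) n≤1+k)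
      searchers (suc (suc c)) n≤d*[1+k] [d-1]*[1+k]<n =
        chain-sweep (pathAdj n) (suc c) path-edge (inj₁ ∘ path-edge⁻¹) 2≤n (s≤s z≤n) n≤d*[1+k] (λ _ → [d-1]*[1+k]<n)

  cycle-layout : ∀ n → 3 ≤ n → Σ (Fin (2 ⊔ ceilDiv n k) → Fin n) (Game.Successful k (cycleAdj n))
  cycle-layout n 3≤n = searchers (ceilDiv n k) (n≤ceilDiv*[1+k] n k) ([ceilDiv∸1]*[1+k]<n n k (≤-trans (s≤s z≤n) 3≤n))
    where
      2≤n : 2 ≤ n
      2≤n = ≤-trans (n≤1+n 2) 3≤n
      two-searchers : n ≤ 2 * suc k → Σ (Fin 2 → Fin n) (Game.Successful k (cycleAdj n))
      two-searchers n≤2*[1+k] = chain-sweep (cycleAdj n) 1 cycle-edge cycle-edge⁻¹ 2≤n (s≤s z≤n) n≤2*[1+k] (λ { (s≤s ()) })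
      searchers : ∀ d → n ≤ d * suc k → (d ∸ 1) * suc k < n → Σ (Fin (2 ⊔ d) → Fin n) (Game.Successful k (cycleAdj n))
      searchers zero n≤0 _ = ⊥-elim (<⇒≱ 3≤n (≤-trans n≤0 z≤n))
      searchers (suc zero) n≤1+k _ = two-searchers (≤-trans n≤1+k (*-monoˡ-≤ (suc k) (n≤1+n 1)))
      searchers (suc (suc zero)) n≤2*[1+k] _ = two-searchers n≤2*[1+k]
      searchers (suc (suc (suc c))) n≤d*[1+k] [d-1]*[1+k]<n =
        chain-sweep (cycleAdj n) (suc (suc c)) cycle-edge cycle-edge⁻¹ 2≤n (s≤s z≤n) n≤d*[1+k] (λ _ → [d-1]*[1+k]<n)

lemma3p4 : (k : ℕ) → 2 ≤ k →
    ((n : ℕ) → 2 ≤ n → IsDeductionNumber k (pathAdj n) (ceilDiv n k))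
    × ((n : ℕ) → 3 ≤ n → IsDeductionNumber k (cycleAdj n) (2 ⊔ ceilDiv n k))
    × ((n : ℕ) → 2 ≤ n → IsDeductionNumber k (completeAdj n) (n ∸ 1))
lemma3p4 k 2≤k = path , cycle , complete
  where
    open UpperBounds k 2≤k using (path-layout; cycle-layout)
    budget : ∀ {n} (G : Adj n) m (p : Fin m → Fin n) → Game.Successful k G p → ceilDiv n k ≤ m
    budget {n} G m p success = ceilDiv-least n k m (GameProperties.successful⇒n≤m*[1+k] k G m p success)
    path : (n : ℕ) → 2 ≤ n → IsDeductionNumber k (pathAdj n) (ceilDiv n k)
    path n 2≤n = path-layout n 2≤n , budget (pathAdj n)
    cycle : (n : ℕ) → 3 ≤ n → IsDeductionNumber k (cycleAdj n) (2 ⊔ ceilDiv n k)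
    cycle n 3≤n = cycle-layout n 3≤n , λ m p success →
      ⊔-lub (CycleLower.lower-bound k n 3≤n m p success) (budget (cycleAdj n) m p success)
    complete : (n : ℕ) → 2 ≤ n → IsDeductionNumber k (completeAdj n) (n ∸ 1)
    complete (suc zero) (s≤s ())
    complete (suc (suc n)) _ = (CompleteUpper.layout k 0<k n , CompleteUpper.successful k 0<k n) ,
                               CompleteLower.lower-bound k (suc (suc n))
      where
        0<k : 0 < k
        0<k = ≤-trans (s≤s z≤n) 2≤k
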